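{- Let $P$ be a graded $1$-Sing poset of rank $d+1$. Then for every integer $i$ with $\lfloor d/2\rfloor<i\le d$, \[ \hat h_{d-i}(P)-\hat h_i(P)=(-1)^{d-i+1}\Big[\binom{d}{i}e_P(\hat0,\hat1)+\binom{d}{i}\sum_{t\in P,\ \rho(t)=d}e_P(\hat0,t)+\binom{d-1}{i-1}\sum_{s\in P,\ \rho(s)=1}e_P(s,\hat1)\Big]. \]
   Context: Posets are finite and graded with unique $\hat0$, $\hat1$, rank function $\rho$ ($\rho(\hat0)=0$), rank $\rho(P)=\rho(\hat1)$, and Möbius function $\mu_P$. For an interval $[s,t]$, $e_P(s,t)=\mu_P(s,t)-(-1)^{\rho(t)-\rho(s)}$. An interval (or poset) $Q$ is Eulerian if $\mu(s,t)=(-1)^{\rho(t)-\rho(s)}$ for all $s\le t$ in $Q$; $P$ of rank $d+1$ is $1$-Sing if every interval of $P$ of length $\rho(t)-\rho(s)\le d-1$ is Eulerian. Toric polynomials: for the one-element poset, $\hat h=\hat g=1$. For $P$ of rank $d+1\ge1$, $\hat h(P,x)=\sum_{t\in P,\ t\ne\hat1}\hat g([\hat0,t],x)(x-1)^{d-\rho(t)}$ (each $[\hat0,t]$ is a graded poset of rank $\rho(t)$); writing $\hat h(P,x)=\sum_{i=0}^d\hat h_i(P)x^{d-i}$, one sets $\hat g(P,x)=\hat h_d+\sum_{m=1}^{\lfloor d/2\rfloor}(\hat h_{d-m}-\hat h_{d-m+1})x^m$. -}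

module Defs where

open import Data.Nat as ℕ using (ℕ; zero; suc; _∸_; _<_; _≤_; ⌊_/2⌋)
open import Data.Nat.Combinatorics using (_C_)
open import Data.Integer as ℤ using (ℤ; +_; -_)
open import Data.Fin as Fin using (Fin)
open import Data.Bool using (Bool; true; false; if_then_else_; _∧_; not)
open import Data.List using (List; []; _∷_; foldr; map)
open import Data.List.Base using (allFin; upTo)
open import Data.Product using (_×_; ∃)
import Data.Sum
open import Relation.Binary.Core using (Rel)
open import Relation.Binary.Definitions using (Decidable)
open import Relation.Binary.Structures using (IsPartialOrder)
open import Relation.Binary.PropositionalEquality using (_≡_)
open import Relation.Nullary using (¬_)
open import Relation.Nullary.Decidable using (⌊_⌋)

record FinGradedPoset : Set₁ where
  field
    n         : ℕ
    _≼_       : Rel (Fin n) _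
    isPO      : IsPartialOrder _≡_ _≼_
    _≼?_      : Decidable _≼_
    bot       : Fin n
    top       : Fin n
    bot-min   : ∀ x → bot ≼ x
    top-max   : ∀ x → x ≼ top
    ρ         : Fin n → ℕ
    ρ-bot     : ρ bot ≡ 0
    ρ-cover   : ∀ s t → s ≼ t → ¬ (s ≡ t) →
                (∀ u → s ≼ u → u ≼ t → (u ≡ s) Data.Sum.⊎ (u ≡ t)) →
                ρ t ≡ suc (ρ s)

open FinGradedPoset public

sumFin : ∀ {n} → (Fin n → ℤ) → ℤ
sumFin f = foldr ℤ._+_ (+ 0) (map f (allFin _))

neg1^ : ℕ → ℤ
neg1^ zero    = + 1
neg1^ (suc k) = - neg1^ k

-- Möbius function (recursive definition  μ(s,s)=1,
-- μ(s,t) = - Σ_{s ≤ u < t} μ(s,u), μ(s,t)=0 if s ≰ t).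
-- Computed with fuel; fuel ρ(t) is always sufficient in a graded poset.

module _ (P : FinGradedPoset) where
  private
    leq : Fin (n P) → Fin (n P) → Bool
    leq s t = ⌊ (_≼?_ P) s t ⌋
    lt : Fin (n P) → Fin (n P) → Bool
    lt s t = leq s t ∧ not ⌊ s Fin.≟ t ⌋

  μ' : ℕ → Fin (n P) → Fin (n P) → ℤ
  μ' fuel s t with ⌊ s Fin.≟ t ⌋ | leq s t
  ... | true  | _     = + 1
  ... | false | false = + 0
  μ' zero       s t | false | true = + 0
  μ' (suc fuel) s t | false | true =
    - sumFin (λ u → if leq s u ∧ lt u t then μ' fuel s u else + 0)

  μ : Fin (n P) → Fin (n P) → ℤ
  μ s t = μ' (ρ P t) s t

  e : Fin (n P) → Fin (n P) → ℤ
  e s t = μ s t ℤ.- neg1^ (ρ P t ∸ ρ P s)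

  IsEulerianInterval : Fin (n P) → Fin (n P) → Set
  IsEulerianInterval s t = ∀ u v → (_≼_ P) s u → (_≼_ P) u v → (_≼_ P) v t →
                           μ u v ≡ neg1^ (ρ P v ∸ ρ P u)

  -- P (of rank d+1) is 1-Sing: every interval of length ≤ d-1 is Eulerian
  OneSing : ℕ → Set
  OneSing d = ∀ s t → (_≼_ P) s t → suc (ρ P t ∸ ρ P s) ≤ d → IsEulerianInterval s t

-- Integer polynomials as coefficient lists (lowest degree first).

Poly : Set
Poly = List ℤ

_+ₚ_ : Poly → Poly → Poly
[]       +ₚ q        = q
p        +ₚ []       = p
(a ∷ p)  +ₚ (b ∷ q)  = (a ℤ.+ b) ∷ (p +ₚ q)

scaleₚ : ℤ → Poly → Poly
scaleₚ c = map (c ℤ.*_)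

_*ₚ_ : Poly → Poly → Poly
[]      *ₚ q = []
(a ∷ p) *ₚ q = scaleₚ a q +ₚ (+ 0 ∷ (p *ₚ q))

_^ₚ_ : Poly → ℕ → Poly
p ^ₚ zero  = + 1 ∷ []
p ^ₚ suc k = p *ₚ (p ^ₚ k)

xMinus1 : Poly
xMinus1 = - (+ 1) ∷ + 1 ∷ []

coeff : Poly → ℕ → ℤ
coeff []      _       = + 0
coeff (a ∷ p) zero    = a
coeff (a ∷ p) (suc k) = coeff p k

sumPoly : List Poly → Poly
sumPoly = foldr _+ₚ_ []

-- Toric h- and g-polynomials of the lower intervals [0̂,t] of P.
-- [0̂,t] is a graded poset of rank ρ(t) with the rank function of P.

module _ (P : FinGradedPoset) where
  private
    ltb : Fin (n P) → Fin (n P) → Bool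
    ltb s t = ⌊ (_≼?_ P) s t ⌋ ∧ not ⌊ s Fin.≟ t ⌋

  -- ĥ([0̂,t]) for ρ(t) = d+1, given ĝ on the proper lower intervals
  hFrom : (Fin (n P) → Poly) → Fin (n P) → ℕ → Poly
  hFrom g t d = sumPoly (map (λ u → if ltb u t
                                     then g u *ₚ (xMinus1 ^ₚ (d ∸ ρ P u))
                                     else [])
                             (allFin _))

  -- ĝ from ĥ:  ĝ = ĥ_d + Σ_{m=1}^{⌊d/2⌋} (ĥ_{d-m} - ĥ_{d-m+1}) x^m,
  -- where ĥ_i = coefficient of x^(d-i).
  gFromH : ℕ → Poly → Poly
  gFromH d h = coeff h 0 ∷ map (λ m → coeff h (suc m) ℤ.- coeff h m) (upTo ⌊ d /2⌋)

  ghat' : ℕ → Fin (n P) → Poly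
  ghat' fuel t with ρ P t
  ... | zero = + 1 ∷ []
  ghat' zero       t | suc d = []
  ghat' (suc fuel) t | suc d = gFromH d (hFrom (ghat' fuel) t d)

  -- ĝ([0̂,t], x)   (fuel ρ(t) suffices)
  ghat : Fin (n P) → Poly
  ghat t = ghat' (ρ P t) t

  hhat : Fin (n P) → ℕ → Poly
  hhat t d = hFrom ghat t d

  hhatCoeff : ℕ → ℕ → ℤ
  hhatCoeff d i = coeff (hhat (top P) d) (d ∸ i)

  sumRank : ℕ → (Fin (n P) → ℤ) → ℤ
  sumRank r f = sumFin (λ t → if ⌊ ρ P t ℕ.≟ r ⌋ then f t else + 0)

module Submission where

-- Work with coefficient sequences and, for t ∈ P, with D_t = (x-1) ĥ([0̂,t]) = Σ_{u<t} ĝ([0̂,u]) (x-1)^(ρt-ρu).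
-- Mirroring each summand and regrouping the resulting double sum gives the reflection identity
--   x^ρt D_t(1/x) + D_t = Σ_{v<t} χ(v,t) (x-1)^(ρt-ρv) ĝ([0̂,v]) - Σ_{u<t} (1-x)^(ρt-ρu) E_u,
-- with χ(v,t) = Σ_{v≤u≤t} (-1)^(ρt-ρu) = -(-1)^(ρt-ρv) Σ_{v≤u≤t} e(v,u) (since Σ μ(v,u) = 0) and
-- E_u = Σ_{w≤u} ĝ([0̂,w]) (x-1)^(ρu-ρw) - x^ρu ĝ([0̂,u],1/x).  In a 1-Sing poset χ vanishes on short
-- intervals, so by induction E_u = 0 whenever ρu < d: the truncation defining ĝ turns antisymmetry of D_u
-- into E_u = 0.  At t = 1̂ only v = 0̂, the atoms v, and the u of rank d survive, and the last only affect
-- coefficients above ⌊(d-1)/2⌋.  Cancelling x - 1 yields ĥ(P,x) - x^d ĥ(P,1/x) explicitly; its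
-- coefficient of x^(d-i) is the stated formula, the binomials coming from (x-1)^d and (x-1)^(d-1).

open import Defs
open import Data.Nat as ℕ using (ℕ; zero; suc; _∸_; _<_; _≤_; z≤n; s≤s; ⌊_/2⌋)
import Data.Nat.Properties as ℕP
open import Data.Nat.Combinatorics using (_C_)
import Data.Nat.Combinatorics as ℕC
open import Data.Integer as ℤ using (ℤ; +_; -_; -[1+_]; _+_; _-_; _*_)
import Data.Integer.Properties as ℤP
open import Data.Integer.Tactic.RingSolver using (solve-∀)
open import Data.Fin as Fin using (Fin)
import Data.Fin.Properties as FinP
open import Data.Bool using (Bool; true; false; if_then_else_; _∧_; not)
open import Data.List using (List; []; _∷_; foldr; map; applyUpTo; upTo; allFin)
import Data.List.Properties as ListP
open import Data.Product using (_×_; _,_; proj₁; proj₂)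
import Data.Vec as Vec
import Data.Vec.Properties as VecP
open import Data.Fin.Subset using (Subset; _∈_; _⊂_; ∣_∣)
open import Data.Fin.Subset.Properties using (p⊂q⇒∣p∣<∣q∣)
open import Data.Sum using (_⊎_; inj₁; inj₂)
open import Data.Empty using (⊥-elim)
open import Function using (_∘_)
open import Relation.Nullary using (yes; no; ¬_; Dec)
open import Relation.Nullary.Decidable using (⌊_⌋; _×-dec_; ¬?)
open import Relation.Binary.Structures using (IsPartialOrder)
open import Relation.Binary.Definitions using (tri<; tri≈; tri>)
open import Relation.Binary.PropositionalEquality
open import Algebra.Properties.Semiring.Sum ℤP.+-*-semiring
  using (sum; sum-syntax; sum-cong-≗; ∑-distrib-+; ∑-comm; *-distribˡ-sum; sum-replicate-zero)
open import Algebra.Properties.AbelianGroup ℤP.+-0-abelianGroup using (inverseˡ-unique; ⁻¹-anti-homo‿-)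

sum-zero : ∀ {n} {f : Fin n → ℤ} → (∀ i → f i ≡ + 0) → sum f ≡ + 0
sum-zero {n} h = trans (sum-cong-≗ h) (sum-replicate-zero n)

∑-distrib-neg : ∀ {n} (f : Fin n → ℤ) → ∑[ i < n ] (- f i) ≡ - sum f
∑-distrib-neg {zero}  f = refl
∑-distrib-neg {suc n} f =
  trans (cong (λ s → - f Fin.zero + s) (∑-distrib-neg (f ∘ Fin.suc))) (sym (ℤP.neg-distrib-+ (f Fin.zero) _))

∑-distrib-- : ∀ {n} (f g : Fin n → ℤ) → ∑[ i < n ] (f i - g i) ≡ sum f - sum g
∑-distrib-- f g = trans (∑-distrib-+ f (λ i → - g i)) (cong (λ s → sum f + s) (∑-distrib-neg g))

*-distribʳ-sum : ∀ {n} (f : Fin n → ℤ) w → ∑[ i < n ] (f i * w) ≡ sum f * w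
*-distribʳ-sum f w =
  trans (sum-cong-≗ (λ i → ℤP.*-comm (f i) w)) (trans (sym (*-distribˡ-sum w f)) (ℤP.*-comm w _))

sum-single : ∀ {n} (f : Fin n → ℤ) t → (∀ u → u ≢ t → f u ≡ + 0) → sum f ≡ f t
sum-single {suc n} f Fin.zero h =
  trans (cong (λ s → f Fin.zero + s) (sum-zero (λ u → h (Fin.suc u) λ ()))) (ℤP.+-identityʳ _)
sum-single {suc n} f (Fin.suc t) h =
  trans (cong (_+ sum (f ∘ Fin.suc)) (h Fin.zero λ ()))
        (trans (ℤP.+-identityˡ _) (sum-single (f ∘ Fin.suc) t λ u u≢t → h (Fin.suc u) (u≢t ∘ FinP.suc-injective)))

sumFin≡sum : ∀ {n} (f : Fin n → ℤ) → sumFin f ≡ sum f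
sumFin≡sum {n} f = trans (cong (foldr _+_ (+ 0)) (ListP.map-tabulate (λ i → i) f)) (foldr-tabulate f)
  where
  foldr-tabulate : ∀ {m} (g : Fin m → ℤ) → foldr _+_ (+ 0) (Data.List.tabulate g) ≡ sum g
  foldr-tabulate {zero}  g = refl
  foldr-tabulate {suc m} g = cong (λ s → g Fin.zero + s) (foldr-tabulate (g ∘ Fin.suc))

⌊⌋-true : ∀ {A : Set} (q : Dec A) → A → ⌊ q ⌋ ≡ true
⌊⌋-true (yes _) a = refl
⌊⌋-true (no ¬a) a = ⊥-elim (¬a a)

⌊⌋-false : ∀ {A : Set} (q : Dec A) → ¬ A → ⌊ q ⌋ ≡ false
⌊⌋-false (yes a) ¬a = ⊥-elim (¬a a)
⌊⌋-false (no _)  ¬a = refl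

⌊⌋-witness : ∀ {A : Set} (q : Dec A) → ⌊ q ⌋ ≡ true → A
⌊⌋-witness (yes a) _ = a

not-⌊⌋-witness : ∀ {A : Set} (q : Dec A) → not ⌊ q ⌋ ≡ true → ¬ A
not-⌊⌋-witness (no ¬a) _ = ¬a

∧-true : ∀ {b c} → b ∧ c ≡ true → b ≡ true × c ≡ true
∧-true {true} {true} _ = refl , refl

∧-false : ∀ b → b ∧ false ≡ false
∧-false true  = refl
∧-false false = refl

when : Bool → ℤ → ℤ
when b x = if b then x else + 0

when-true : ∀ {A : Set} (q : Dec A) {x} → A → when ⌊ q ⌋ x ≡ x
when-true (yes _) a = refl
when-true (no ¬a) a = ⊥-elim (¬a a)

when-false : ∀ {A : Set} (q : Dec A) {x} → ¬ A → when ⌊ q ⌋ x ≡ + 0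
when-false (yes a) ¬a = ⊥-elim (¬a a)
when-false (no _)  ¬a = refl

when-cong : ∀ b {x y} → (b ≡ true → x ≡ y) → when b x ≡ when b y
when-cong true  h = h refl
when-cong false h = refl

when-zero : ∀ b {x} → (b ≡ true → x ≡ + 0) → when b x ≡ + 0
when-zero true  h = h refl
when-zero false h = refl

when-* : ∀ b s w → when b (s * w) ≡ when b s * w
when-* true  s w = refl
when-* false s w = refl

when-- : ∀ b x y → when b (x - y) ≡ when b x - when b y
when-- true  x y = refl
when-- false x y = refl

sum-when-≡ : ∀ {n} (f : Fin n → ℤ) t → ∑[ u < n ] when ⌊ u Fin.≟ t ⌋ (f u) ≡ f t
sum-when-≡ f t =
  trans (sum-single _ t λ u u≢t → when-false (u Fin.≟ t) u≢t) (when-true (t Fin.≟ t) refl)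

when-∧ : ∀ b c x → when (b ∧ c) x ≡ when b (when c x)
when-∧ true  c x = refl
when-∧ false c x = refl

when-linear : ∀ b c {x} y z → (b ≡ true → x ≡ c * (y - z)) → when b x ≡ c * (when b y - when b z)
when-linear true  c y z h = h refl
when-linear false c y z h = sym (ℤP.*-zeroʳ c)

when-*-when : ∀ b₁ b₂ s y → when b₁ (s * when b₂ y) ≡ when (b₂ ∧ b₁) (s * y)
when-*-when true  true  s y = refl
when-*-when true  false s y = ℤP.*-zeroʳ s
when-*-when false b₂    s y rewrite ∧-false b₂ = refl

neg1^-+ : ∀ a b → neg1^ (a ℕ.+ b) ≡ neg1^ a * neg1^ b
neg1^-+ zero    b = sym (ℤP.*-identityˡ _)
neg1^-+ (suc a) b = trans (cong -_ (neg1^-+ a b)) (ℤP.neg-distribˡ-* (neg1^ a) (neg1^ b))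

neg1^-square : ∀ a → neg1^ a * neg1^ a ≡ + 1
neg1^-square zero    = refl
neg1^-square (suc a) = trans (square-neg (neg1^ a)) (neg1^-square a)
  where
  square-neg : ∀ x → - x * - x ≡ x * x
  square-neg = solve-∀

∸-telescope : ∀ {a b c} → a ≤ b → b ≤ c → (c ∸ b) ℕ.+ (b ∸ a) ≡ c ∸ a
∸-telescope {a} {b} {c} a≤b b≤c =
  trans (sym (ℕP.+-∸-assoc (c ∸ b) a≤b)) (cong (_∸ a) (ℕP.m∸n+n≡m b≤c))

neg1^-∸ : ∀ {a b c} → a ≤ b → b ≤ c → neg1^ (c ∸ b) ≡ neg1^ (c ∸ a) * neg1^ (b ∸ a)
neg1^-∸ {a} {b} {c} a≤b b≤c = begin
  neg1^ (c ∸ b)                                   ≡⟨ sym (ℤP.*-identityʳ _) ⟩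
  neg1^ (c ∸ b) * + 1                             ≡⟨ cong (neg1^ (c ∸ b) *_) (sym (neg1^-square (b ∸ a))) ⟩
  neg1^ (c ∸ b) * (neg1^ (b ∸ a) * neg1^ (b ∸ a)) ≡⟨ sym (ℤP.*-assoc (neg1^ (c ∸ b)) _ _) ⟩
  neg1^ (c ∸ b) * neg1^ (b ∸ a) * neg1^ (b ∸ a)   ≡⟨ cong (_* neg1^ (b ∸ a)) (sym (neg1^-+ (c ∸ b) (b ∸ a))) ⟩
  neg1^ ((c ∸ b) ℕ.+ (b ∸ a)) * neg1^ (b ∸ a)     ≡⟨ cong (λ m → neg1^ m * neg1^ (b ∸ a)) (∸-telescope a≤b b≤c) ⟩
  neg1^ (c ∸ a) * neg1^ (b ∸ a)                   ∎
  where open ≡-Reasoning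

Coeffs : Set
Coeffs = ℕ → ℤ

δ₀ : Coeffs
δ₀ zero    = + 1
δ₀ (suc _) = + 0

infixr 8 x-1·_ [x-1]^_·_

x-1·_ : Coeffs → Coeffs
(x-1· f) zero    = - f zero
(x-1· f) (suc k) = f k - f (suc k)

[x-1]^_·_ : ℕ → Coeffs → Coeffs
[x-1]^ zero  · f = f
[x-1]^ suc m · f = x-1· [x-1]^ m · f

x-1·-cong : ∀ {f g} → f ≗ g → x-1· f ≗ x-1· g
x-1·-cong f≗g zero    = cong -_ (f≗g zero)
x-1·-cong f≗g (suc k) = cong₂ _-_ (f≗g k) (f≗g (suc k))

[x-1]^-cong : ∀ m {f g} → f ≗ g → [x-1]^ m · f ≗ [x-1]^ m · g
[x-1]^-cong zero    f≗g = f≗g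
[x-1]^-cong (suc m) f≗g = x-1·-cong ([x-1]^-cong m f≗g)

[x-1]^-+ : ∀ a b f → [x-1]^ a · [x-1]^ b · f ≡ [x-1]^ (a ℕ.+ b) · f
[x-1]^-+ zero    b f = refl
[x-1]^-+ (suc a) b f = cong x-1·_ ([x-1]^-+ a b f)

x-1·-* : ∀ c f → x-1· (λ k → c * f k) ≗ (λ k → c * (x-1· f) k)
x-1·-* c f zero    = ℤP.neg-distribʳ-* c (f zero)
x-1·-* c f (suc k) = lemma c (f k) (f (suc k))
  where
  lemma : ∀ a x y → a * x - a * y ≡ a * (x - y)
  lemma = solve-∀

x-1·-+ : ∀ f g → x-1· (λ k → f k + g k) ≗ (λ k → (x-1· f) k + (x-1· g) k)
x-1·-+ f g zero    = ℤP.neg-distrib-+ (f zero) (g zero)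
x-1·-+ f g (suc k) = lemma (f k) (g k) (f (suc k)) (g (suc k))
  where
  lemma : ∀ a b c d → a + b - (c + d) ≡ a - c + (b - d)
  lemma = solve-∀

x-1·-- : ∀ f g → x-1· (λ k → f k - g k) ≗ (λ k → (x-1· f) k - (x-1· g) k)
x-1·-- f g zero    = lemma (f zero) (g zero)
  where
  lemma : ∀ a b → - (a - b) ≡ - a - - b
  lemma = solve-∀
x-1·-- f g (suc k) = lemma (f k) (g k) (f (suc k)) (g (suc k))
  where
  lemma : ∀ a b c d → a - b - (c - d) ≡ a - c - (b - d)
  lemma = solve-∀

x-1·-sum : ∀ {n} (F : Fin n → Coeffs) →
           x-1· (λ k → ∑[ u < n ] F u k) ≗ (λ k → ∑[ u < n ] (x-1· F u) k)
x-1·-sum F zero    = sym (∑-distrib-neg (λ u → F u zero))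
x-1·-sum F (suc k) = sym (∑-distrib-- (λ u → F u k) (λ u → F u (suc k)))

x-1·-when : ∀ b f → x-1· (λ k → when b (f k)) ≗ (λ k → when b ((x-1· f) k))
x-1·-when true  f k       = refl
x-1·-when false f zero    = refl
x-1·-when false f (suc k) = refl

[x-1]^-- : ∀ m f g → [x-1]^ m · (λ k → f k - g k) ≗ (λ k → ([x-1]^ m · f) k - ([x-1]^ m · g) k)
[x-1]^-- zero    f g k = refl
[x-1]^-- (suc m) f g k = trans (x-1·-cong ([x-1]^-- m f g) k) (x-1·-- ([x-1]^ m · f) ([x-1]^ m · g) k)

[x-1]^-sum : ∀ {n} m (F : Fin n → Coeffs) →
             [x-1]^ m · (λ k → ∑[ u < n ] F u k) ≗ (λ k → ∑[ u < n ] ([x-1]^ m · F u) k)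
[x-1]^-sum zero    F k = refl
[x-1]^-sum (suc m) F k = trans (x-1·-cong ([x-1]^-sum m F) k) (x-1·-sum (λ u → [x-1]^ m · F u) k)

[x-1]^-zero : ∀ m → [x-1]^ m · (λ _ → + 0) ≗ (λ _ → + 0)
[x-1]^-zero zero    k       = refl
[x-1]^-zero (suc m) zero    = cong -_ ([x-1]^-zero m zero)
[x-1]^-zero (suc m) (suc k) = cong₂ _-_ ([x-1]^-zero m k) ([x-1]^-zero m (suc k))

[x-1]^-when : ∀ m b f → [x-1]^ m · (λ k → when b (f k)) ≗ (λ k → when b (([x-1]^ m · f) k))
[x-1]^-when m true  f k = refl
[x-1]^-when m false f k = [x-1]^-zero m k

x-1·-injective : ∀ {f g} → x-1· f ≗ x-1· g → f ≗ g
x-1·-injective h zero    = ℤP.neg-injective (h zero)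
x-1·-injective {f} {g} h (suc k) =
  cancel (f k) (g k) (f (suc k)) (g (suc k)) (x-1·-injective h k) (h (suc k))
  where
  cancel : ∀ a b c d → a ≡ b → a - c ≡ b - d → c ≡ d
  cancel a .a c d refl e = trans (sym (undo a c)) (trans (cong (λ x → a - x) e) (undo a d))
    where
    undo : ∀ a c → a - (a - c) ≡ c
    undo = solve-∀

pascal-signed : ∀ n k x → neg1^ (n ∸ k) * x - neg1^ (n ∸ suc k) * + (n C suc k)
                          ≡ neg1^ (n ∸ k) * (x + + (n C suc k))
pascal-signed n k x with k ℕ.<? n
... | yes k<n = alternating (cong neg1^ (ℕP.+-∸-assoc 1 k<n))
  where
  alternating : ∀ {s t} → s ≡ - t → s * x - t * + (n C suc k) ≡ s * (x + + (n C suc k))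
  alternating {t = t} refl = lemma t x (+ (n C suc k))
    where
    lemma : ∀ t a b → - t * a - t * b ≡ - t * (a + b)
    lemma = solve-∀
... | no k≮n rewrite ℕC.k>n⇒nCk≡0 (s≤s (ℕP.≮⇒≥ k≮n)) = lemma (neg1^ (n ∸ k)) (neg1^ (n ∸ suc k)) x
  where
  lemma : ∀ s t a → s * a - t * + 0 ≡ s * (a + + 0)
  lemma = solve-∀

[x-1]^-δ₀ : ∀ n k → ([x-1]^ n · δ₀) k ≡ neg1^ (n ∸ k) * + (n C k)
[x-1]^-δ₀ zero    zero    = refl
[x-1]^-δ₀ zero    (suc k) = refl
[x-1]^-δ₀ (suc n) zero    = begin
  - ([x-1]^ n · δ₀) zero     ≡⟨ cong -_ ([x-1]^-δ₀ n zero) ⟩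
  - (neg1^ n * + (n C 0))    ≡⟨ cong (λ c → - (neg1^ n * + c)) (nC0≡1 n) ⟩
  - (neg1^ n * + 1)          ≡⟨ ℤP.neg-distribˡ-* (neg1^ n) (+ 1) ⟩
  neg1^ (suc n) * + 1        ≡⟨ cong (λ c → neg1^ (suc n) * + c) (sym (nC0≡1 (suc n))) ⟩
  neg1^ (suc n) * + (suc n C 0) ∎
  where
  open ≡-Reasoning
  nC0≡1 : ∀ n → n C 0 ≡ 1
  nC0≡1 n = trans (ℕC.nCk≡nC[n∸k] {0} {n} z≤n) (ℕC.nCn≡1 n)
[x-1]^-δ₀ (suc n) (suc k) = begin
  ([x-1]^ n · δ₀) k - ([x-1]^ n · δ₀) (suc k)
    ≡⟨ cong₂ _-_ ([x-1]^-δ₀ n k) ([x-1]^-δ₀ n (suc k)) ⟩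
  neg1^ (n ∸ k) * + (n C k) - neg1^ (n ∸ suc k) * + (n C suc k)
    ≡⟨ pascal-signed n k (+ (n C k)) ⟩
  neg1^ (n ∸ k) * (+ (n C k) + + (n C suc k))
    ≡⟨ cong (λ c → neg1^ (n ∸ k) * c) (sym (ℤP.pos-+ (n C k) (n C suc k))) ⟩
  neg1^ (n ∸ k) * + (n C k ℕ.+ n C suc k)
    ≡⟨ cong (λ c → neg1^ (n ∸ k) * + c) (ℕC.nCk+nC[k+1]≡[n+1]C[k+1] n k) ⟩
  neg1^ (n ∸ k) * + (suc n C suc k) ∎
  where open ≡-Reasoning

DegreeAtMost : ℕ → Coeffs → Set
DegreeAtMost n f = ∀ k → n < k → f k ≡ + 0

x-1·-degree : ∀ {n f} → DegreeAtMost n f → DegreeAtMost (suc n) (x-1· f)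
x-1·-degree {n} {f} deg (suc k) (s≤s n<k)
  rewrite deg k n<k | deg (suc k) (ℕP.m<n⇒m<1+n n<k) = refl

[x-1]^-degree : ∀ m {n f} → DegreeAtMost n f → DegreeAtMost (m ℕ.+ n) ([x-1]^ m · f)
[x-1]^-degree zero    deg = deg
[x-1]^-degree (suc m) deg = x-1·-degree ([x-1]^-degree m deg)

-- The coefficients of xⁿ f(1/x); this is the reversal of f only when f has degree at most n.
mirror : ℕ → Coeffs → Coeffs
mirror n f k = when ⌊ k ℕ.≤? n ⌋ (f (n ∸ k))

mirror-≤ : ∀ {n k} f → k ≤ n → mirror n f k ≡ f (n ∸ k)
mirror-≤ {n} {k} f k≤n = when-true (k ℕ.≤? n) k≤n

mirror-> : ∀ {n k} f → n < k → mirror n f k ≡ + 0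
mirror-> {n} {k} f n<k = when-false (k ℕ.≤? n) (ℕP.<⇒≱ n<k)

mirror-cong : ∀ n {f g} → f ≗ g → mirror n f ≗ mirror n g
mirror-cong n f≗g k = when-cong ⌊ k ℕ.≤? n ⌋ λ _ → f≗g (n ∸ k)

when-sum : ∀ {N} b (f : Fin N → ℤ) → when b (sum f) ≡ ∑[ u < N ] when b (f u)
when-sum true  f = refl
when-sum {N} false f = sym (sum-zero {N} λ _ → refl)

when-when : ∀ b c x → when b (when c x) ≡ when c (when b x)
when-when true  c x = refl
when-when false c x = sym (when-zero c λ _ → refl)

mirror-sum : ∀ {N} n (F : Fin N → Coeffs) →
             mirror n (λ k → ∑[ u < N ] F u k) ≗ (λ k → ∑[ u < N ] mirror n (F u) k)
mirror-sum n F k = when-sum ⌊ k ℕ.≤? n ⌋ (λ u → F u (n ∸ k))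

mirror-when : ∀ n b f → mirror n (λ k → when b (f k)) ≗ (λ k → when b (mirror n f k))
mirror-when n b f k = when-when ⌊ k ℕ.≤? n ⌋ b (f (n ∸ k))

mirror-x-1· : ∀ {n f} → DegreeAtMost n f → mirror (suc n) (x-1· f) ≗ (λ k → - (x-1· mirror n f) k)
mirror-x-1· {n} {f} deg zero
  rewrite mirror-≤ {suc n} {0} (x-1· f) z≤n | mirror-≤ {n} {0} f z≤n | deg (suc n) ℕP.≤-refl =
  lemma (f n)
  where
  lemma : ∀ a → a - + 0 ≡ - - a
  lemma = solve-∀
mirror-x-1· {n} {f} deg (suc j) with ℕP.<-cmp j n
... | tri< j<n _ _
  rewrite mirror-≤ {suc n} {suc j} (x-1· f) (s≤s (ℕP.<⇒≤ j<n)) | mirror-≤ {n} {j} f (ℕP.<⇒≤ j<n)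
        | mirror-≤ {n} {suc j} f j<n | ℕP.+-∸-assoc 1 j<n =
  lemma (f (n ∸ suc j)) (f (suc (n ∸ suc j)))
  where
  lemma : ∀ a b → a - b ≡ - (b - a)
  lemma = solve-∀
... | tri≈ _ refl _
  rewrite mirror-≤ {suc n} {suc n} (x-1· f) ℕP.≤-refl | mirror-≤ {n} {n} f ℕP.≤-refl
        | mirror-> {n} {suc n} f ℕP.≤-refl | ℕP.n∸n≡0 n =
  lemma (f 0)
  where
  lemma : ∀ a → - a ≡ - (a - + 0)
  lemma = solve-∀
... | tri> _ _ n<j
  rewrite mirror-> {suc n} {suc j} (x-1· f) (s≤s n<j) | mirror-> {n} {j} f n<j
        | mirror-> {n} {suc j} f (ℕP.m<n⇒m<1+n n<j) = refl

mirror-[x-1]^ : ∀ m {n f} → DegreeAtMost n f →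
                mirror (m ℕ.+ n) ([x-1]^ m · f) ≗ (λ k → neg1^ m * ([x-1]^ m · mirror n f) k)
mirror-[x-1]^ zero    {n} {f} deg k = sym (ℤP.*-identityˡ _)
mirror-[x-1]^ (suc m) {n} {f} deg k = begin
  mirror (suc m ℕ.+ n) (x-1· [x-1]^ m · f) k
    ≡⟨ mirror-x-1· ([x-1]^-degree m deg) k ⟩
  - (x-1· mirror (m ℕ.+ n) ([x-1]^ m · f)) k
    ≡⟨ cong -_ (x-1·-cong (mirror-[x-1]^ m deg) k) ⟩
  - (x-1· (λ k → neg1^ m * ([x-1]^ m · mirror n f) k)) k
    ≡⟨ cong -_ (x-1·-* (neg1^ m) ([x-1]^ m · mirror n f) k) ⟩
  - (neg1^ m * ([x-1]^ suc m · mirror n f) k)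
    ≡⟨ ℤP.neg-distribˡ-* (neg1^ m) _ ⟩
  neg1^ (suc m) * ([x-1]^ suc m · mirror n f) k ∎
  where open ≡-Reasoning

⌊n/2⌋+⌊n/2⌋≤n : ∀ n → ⌊ n /2⌋ ℕ.+ ⌊ n /2⌋ ≤ n
⌊n/2⌋+⌊n/2⌋≤n zero          = z≤n
⌊n/2⌋+⌊n/2⌋≤n (suc zero)    = z≤n
⌊n/2⌋+⌊n/2⌋≤n (suc (suc n)) rewrite ℕP.+-suc ⌊ n /2⌋ ⌊ n /2⌋ = s≤s (s≤s (⌊n/2⌋+⌊n/2⌋≤n n))

n≤1+⌊n/2⌋+⌊n/2⌋ : ∀ n → n ≤ suc (⌊ n /2⌋ ℕ.+ ⌊ n /2⌋)
n≤1+⌊n/2⌋+⌊n/2⌋ zero          = z≤n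
n≤1+⌊n/2⌋+⌊n/2⌋ (suc zero)    = s≤s z≤n
n≤1+⌊n/2⌋+⌊n/2⌋ (suc (suc n)) rewrite ℕP.+-suc ⌊ n /2⌋ ⌊ n /2⌋ = s≤s (s≤s (n≤1+⌊n/2⌋+⌊n/2⌋ n))

low⇒mirror-high : ∀ r {k} → k ≤ ⌊ r /2⌋ → ⌊ r /2⌋ < suc r ∸ k
low⇒mirror-high r {k} k≤ = ℕP.m+n≤o⇒m≤o∸n (suc ⌊ r /2⌋)
  (s≤s (ℕP.≤-trans (ℕP.+-monoʳ-≤ ⌊ r /2⌋ k≤) (⌊n/2⌋+⌊n/2⌋≤n r)))

high-and-mirror-high⇒middle : ∀ r {k} → k ≤ suc r → ⌊ r /2⌋ < k → ⌊ r /2⌋ < suc r ∸ k → k ≡ suc r ∸ k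
high-and-mirror-high⇒middle r {k} k≤ k> k′> = squeeze
  (ℕP.≤-trans (ℕP.≤-reflexive (ℕP.m+[n∸m]≡n k≤))
              (ℕP.≤-trans (s≤s (n≤1+⌊n/2⌋+⌊n/2⌋ r)) (ℕP.≤-reflexive (sym (ℕP.+-suc (suc ⌊ r /2⌋) ⌊ r /2⌋)))))
  k> k′>
  where
  squeeze : ∀ {x y c} → x ℕ.+ y ≤ c ℕ.+ c → c ≤ x → c ≤ y → x ≡ y
  squeeze {x} {y} {c} x+y≤ c≤x c≤y = trans (ℕP.≤-antisym x≤c c≤x) (ℕP.≤-antisym c≤y y≤c)
    where
    x≤c : x ≤ c
    x≤c = ℕP.+-cancelˡ-≤ c x c (ℕP.≤-trans (ℕP.≤-reflexive (ℕP.+-comm c x)) (ℕP.≤-trans (ℕP.+-monoʳ-≤ x c≤y) x+y≤))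
    y≤c : y ≤ c
    y≤c = ℕP.+-cancelˡ-≤ c y c (ℕP.≤-trans (ℕP.+-monoˡ-≤ y c≤x) x+y≤)

self-negative⇒0 : ∀ {x} → x ≡ - x → x ≡ + 0
self-negative⇒0 {+ zero}   _  = refl
self-negative⇒0 {+ suc n}  ()
self-negative⇒0 { -[1+ n ]} ()

-- Used with d = (x - 1)ĥ([0̂,t]) and g = ĝ([0̂,t]), the truncation of -(x - 1)ĥ described by the hypotheses.
truncation-palindromic : ∀ r (d g : Coeffs) → DegreeAtMost (suc r) d →
  (∀ k → k ≤ suc r → d (suc r ∸ k) ≡ - d k) →
  (∀ k → k ≤ ⌊ r /2⌋ → g k ≡ - d k) → (∀ k → ⌊ r /2⌋ < k → g k ≡ + 0) →
  ∀ k → d k + g k - mirror (suc r) g k ≡ + 0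
truncation-palindromic r d g deg anti low high k with k ℕ.≤? suc r
... | no k≰ rewrite deg k (ℕP.≰⇒> k≰) | high k (ℕP.≤-<-trans (ℕP.⌊n/2⌋≤n r) (ℕP.<-≤-trans (ℕP.n<1+n r) (ℕP.<⇒≤ (ℕP.≰⇒> k≰)))) = refl
... | yes k≤ with k ℕ.≤? ⌊ r /2⌋
...   | yes k-low rewrite low k k-low | high (suc r ∸ k) (low⇒mirror-high r k-low) = lemma (d k)
  where
  lemma : ∀ a → a + - a - + 0 ≡ + 0
  lemma = solve-∀
...   | no k-high with (suc r ∸ k) ℕ.≤? ⌊ r /2⌋
...     | yes k′-low rewrite high k (ℕP.≰⇒> k-high) | low (suc r ∸ k) k′-low | anti k k≤ = lemma (d k)
  where
  lemma : ∀ a → a + + 0 - - - a ≡ + 0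
  lemma = solve-∀
...     | no k′-high rewrite high k (ℕP.≰⇒> k-high) | high (suc r ∸ k) (ℕP.≰⇒> k′-high) =
  trans (lemma (d k)) (self-negative⇒0 (trans (cong d middle) (anti k k≤)))
  where
  middle = high-and-mirror-high⇒middle r k≤ (ℕP.≰⇒> k-high) (ℕP.≰⇒> k′-high)
  lemma : ∀ a → a + + 0 - + 0 ≡ a
  lemma = solve-∀

infixr 8 x·_

x·_ : Coeffs → Coeffs
(x· f) zero    = + 0
(x· f) (suc k) = f k

x·-cong : ∀ {f g} → f ≗ g → x· f ≗ x· g
x·-cong f≗g zero    = refl
x·-cong f≗g (suc k) = f≗g k

x-1·-x· : ∀ f → x-1· x· f ≗ x· x-1· f
x-1·-x· f zero          = refl
x-1·-x· f (suc zero)    = ℤP.+-identityˡ _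
x-1·-x· f (suc (suc k)) = refl

coeff-+ₚ : ∀ p q k → coeff (p +ₚ q) k ≡ coeff p k + coeff q k
coeff-+ₚ []      q       k       = sym (ℤP.+-identityˡ _)
coeff-+ₚ (a ∷ p) []      k       = sym (ℤP.+-identityʳ _)
coeff-+ₚ (a ∷ p) (b ∷ q) zero    = refl
coeff-+ₚ (a ∷ p) (b ∷ q) (suc k) = coeff-+ₚ p q k

coeff-scaleₚ : ∀ c p k → coeff (scaleₚ c p) k ≡ c * coeff p k
coeff-scaleₚ c []      k       = sym (ℤP.*-zeroʳ c)
coeff-scaleₚ c (a ∷ p) zero    = refl
coeff-scaleₚ c (a ∷ p) (suc k) = coeff-scaleₚ c p k

coeff-0∷ : ∀ p → coeff (+ 0 ∷ p) ≗ x· coeff p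
coeff-0∷ p zero    = refl
coeff-0∷ p (suc k) = refl

coeff-∷-*ₚ : ∀ a p q → coeff ((a ∷ p) *ₚ q) ≗ (λ k → a * coeff q k + (x· coeff (p *ₚ q)) k)
coeff-∷-*ₚ a p q k = trans (coeff-+ₚ (scaleₚ a q) _ k) (cong₂ _+_ (coeff-scaleₚ a q k) (coeff-0∷ _ k))

coeff-[]-*ₚ : ∀ q → x· coeff ([] *ₚ q) ≗ (λ _ → + 0)
coeff-[]-*ₚ q zero    = refl
coeff-[]-*ₚ q (suc k) = refl

coeff-xMinus1-*ₚ : ∀ q → coeff (xMinus1 *ₚ q) ≗ x-1· coeff q
coeff-xMinus1-*ₚ q k = trans (coeff-∷-*ₚ (- + 1) (+ 1 ∷ []) q k) (combine k)
  where
  coeff-1-*ₚ : coeff ((+ 1 ∷ []) *ₚ q) ≗ coeff q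
  coeff-1-*ₚ k = trans (coeff-∷-*ₚ (+ 1) [] q k)
    (trans (cong (λ x → + 1 * coeff q k + x) (coeff-[]-*ₚ q k)) (lemma (coeff q k)))
    where
    lemma : ∀ a → + 1 * a + + 0 ≡ a
    lemma = solve-∀
  combine : ∀ k → - + 1 * coeff q k + (x· coeff ((+ 1 ∷ []) *ₚ q)) k ≡ (x-1· coeff q) k
  combine zero    = lemma (coeff q 0)
    where
    lemma : ∀ a → - + 1 * a + + 0 ≡ - a
    lemma = solve-∀
  combine (suc k) rewrite coeff-1-*ₚ k = lemma (coeff q (suc k)) (coeff q k)
    where
    lemma : ∀ a b → - + 1 * a + b ≡ b - a
    lemma = solve-∀

coeff-*ₚ-xMinus1-*ₚ : ∀ p q → coeff (p *ₚ (xMinus1 *ₚ q)) ≗ x-1· coeff (p *ₚ q)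
coeff-*ₚ-xMinus1-*ₚ []      q zero    = refl
coeff-*ₚ-xMinus1-*ₚ []      q (suc k) = refl
coeff-*ₚ-xMinus1-*ₚ (a ∷ p) q k = begin
  coeff ((a ∷ p) *ₚ (xMinus1 *ₚ q)) k
    ≡⟨ coeff-∷-*ₚ a p (xMinus1 *ₚ q) k ⟩
  a * coeff (xMinus1 *ₚ q) k + (x· coeff (p *ₚ (xMinus1 *ₚ q))) k
    ≡⟨ cong₂ _+_ (cong (a *_) (coeff-xMinus1-*ₚ q k))
                 (trans (x·-cong (coeff-*ₚ-xMinus1-*ₚ p q) k) (sym (x-1·-x· (coeff (p *ₚ q)) k))) ⟩
  a * (x-1· coeff q) k + (x-1· x· coeff (p *ₚ q)) k
    ≡⟨ cong (_+ (x-1· x· coeff (p *ₚ q)) k) (sym (x-1·-* a (coeff q) k)) ⟩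
  (x-1· (λ k → a * coeff q k)) k + (x-1· x· coeff (p *ₚ q)) k
    ≡⟨ sym (x-1·-+ (λ k → a * coeff q k) (x· coeff (p *ₚ q)) k) ⟩
  (x-1· (λ k → a * coeff q k + (x· coeff (p *ₚ q)) k)) k
    ≡⟨ sym (x-1·-cong (coeff-∷-*ₚ a p q) k) ⟩
  (x-1· coeff ((a ∷ p) *ₚ q)) k ∎
  where open ≡-Reasoning

coeff-*ₚ-1 : ∀ p → coeff (p *ₚ (+ 1 ∷ [])) ≗ coeff p
coeff-*ₚ-1 []      k       = refl
coeff-*ₚ-1 (a ∷ p) zero    = trans (coeff-∷-*ₚ a p (+ 1 ∷ []) zero) (lemma a)
  where
  lemma : ∀ a → a * + 1 + + 0 ≡ a
  lemma = solve-∀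
coeff-*ₚ-1 (a ∷ p) (suc k) =
  trans (coeff-∷-*ₚ a p (+ 1 ∷ []) (suc k)) (trans (cong (λ x → a * + 0 + x) (coeff-*ₚ-1 p k)) (lemma a _))
  where
  lemma : ∀ a b → a * + 0 + b ≡ b
  lemma = solve-∀

coeff-*ₚ-xMinus1^ : ∀ m p → coeff (p *ₚ (xMinus1 ^ₚ m)) ≗ [x-1]^ m · coeff p
coeff-*ₚ-xMinus1^ zero    p = coeff-*ₚ-1 p
coeff-*ₚ-xMinus1^ (suc m) p k =
  trans (coeff-*ₚ-xMinus1-*ₚ p (xMinus1 ^ₚ m) k) (x-1·-cong (coeff-*ₚ-xMinus1^ m p) k)

coeff-sumPoly-allFin : ∀ {n} (f : Fin n → Poly) k →
                       coeff (sumPoly (map f (allFin n))) k ≡ ∑[ u < n ] coeff (f u) k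
coeff-sumPoly-allFin {n} f k = trans (coeff-sumPoly (allFin n)) (sumFin≡sum (λ u → coeff (f u) k))
  where
  coeff-sumPoly : ∀ us → coeff (sumPoly (map f us)) k ≡ foldr _+_ (+ 0) (map (λ u → coeff (f u) k) us)
  coeff-sumPoly []       = refl
  coeff-sumPoly (u ∷ us) = trans (coeff-+ₚ (f u) _ k) (cong (λ s → coeff (f u) k + s) (coeff-sumPoly us))

coeff-map-applyUpTo-< : ∀ (F : ℕ → ℤ) g L m → m < L → coeff (map F (applyUpTo g L)) m ≡ F (g m)
coeff-map-applyUpTo-< F g (suc L) zero    _         = refl
coeff-map-applyUpTo-< F g (suc L) (suc m) (s≤s m<L) = coeff-map-applyUpTo-< F (g ∘ suc) L m m<L

coeff-map-applyUpTo-≥ : ∀ (F : ℕ → ℤ) g L m → L ≤ m → coeff (map F (applyUpTo g L)) m ≡ + 0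
coeff-map-applyUpTo-≥ F g zero    m       _         = refl
coeff-map-applyUpTo-≥ F g (suc L) (suc m) (s≤s L≤m) = coeff-map-applyUpTo-≥ F (g ∘ suc) L m L≤m

module _ (P : FinGradedPoset) where

  private
    N : ℕ
    N = n P

    infix 4 _≤ₚ_

    _≤ₚ_ : Fin N → Fin N → Set
    _≤ₚ_ = _≼_ P

  open IsPartialOrder (isPO P) using (antisym) renaming (refl to ≤ₚ-refl; trans to ≤ₚ-trans)

  infix 7 _≤ᵇ_ _<ᵇ_

  _≤ᵇ_ : Fin N → Fin N → Bool
  s ≤ᵇ t = ⌊ (_≼?_ P) s t ⌋

  _<ᵇ_ : Fin N → Fin N → Bool
  s <ᵇ t = s ≤ᵇ t ∧ not ⌊ s Fin.≟ t ⌋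

  ≤ᵇ-true : ∀ {s t} → s ≤ₚ t → (s ≤ᵇ t) ≡ true
  ≤ᵇ-true {s} {t} = ⌊⌋-true ((_≼?_ P) s t)

  ≤ᵇ-sound : ∀ {s t} → (s ≤ᵇ t) ≡ true → s ≤ₚ t
  ≤ᵇ-sound {s} {t} = ⌊⌋-witness ((_≼?_ P) s t)

  <ᵇ-true : ∀ {s t} → s ≤ₚ t → s ≢ t → (s <ᵇ t) ≡ true
  <ᵇ-true {s} {t} s≤t s≢t rewrite ≤ᵇ-true s≤t | ⌊⌋-false (s Fin.≟ t) s≢t = refl

  <ᵇ-sound : ∀ {s t} → (s <ᵇ t) ≡ true → s ≤ₚ t × s ≢ t
  <ᵇ-sound {s} {t} e with ∧-true e
  ... | s≤t , s≢t = ≤ᵇ-sound s≤t , not-⌊⌋-witness (s Fin.≟ t) s≢t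

  ≤ᵇ∧≤ᵇ-sound : ∀ {s t u} → (s ≤ᵇ u ∧ u ≤ᵇ t) ≡ true → s ≤ₚ u × u ≤ₚ t
  ≤ᵇ∧≤ᵇ-sound e with ∧-true e
  ... | s≤u , u≤t = ≤ᵇ-sound s≤u , ≤ᵇ-sound u≤t

  ≤ᵇ∧<ᵇ-sound : ∀ {s t u} → (s ≤ᵇ u ∧ u <ᵇ t) ≡ true → s ≤ₚ u × u ≤ₚ t × u ≢ t
  ≤ᵇ∧<ᵇ-sound e with ∧-true e
  ... | s≤u , u<t with <ᵇ-sound u<t
  ...   | u≤t , u≢t = ≤ᵇ-sound s≤u , u≤t , u≢t

  interval : Fin N → Fin N → Subset N
  interval s t = Vec.tabulate (λ u → s ≤ᵇ u ∧ u ≤ᵇ t)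

  ∈-interval⁻ : ∀ {s t u} → u ∈ interval s t → s ≤ₚ u × u ≤ₚ t
  ∈-interval⁻ {s} {t} {u} u∈ =
    ≤ᵇ∧≤ᵇ-sound (trans (sym (VecP.lookup∘tabulate (λ u → s ≤ᵇ u ∧ u ≤ᵇ t) u)) (VecP.[]=⇒lookup u∈))

  ∈-interval⁺ : ∀ {s t u} → s ≤ₚ u → u ≤ₚ t → u ∈ interval s t
  ∈-interval⁺ {s} {t} {u} s≤u u≤t = VecP.lookup⇒[]= u (interval s t)
    (trans (VecP.lookup∘tabulate (λ u → s ≤ᵇ u ∧ u ≤ᵇ t) u) (cong₂ _∧_ (≤ᵇ-true s≤u) (≤ᵇ-true u≤t)))

  interval-⊂ˡ : ∀ {s t u} → s ≤ₚ t → u ≤ₚ t → u ≢ t → interval s u ⊂ interval s t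
  interval-⊂ˡ {s} {t} {u} s≤t u≤t u≢t =
    (λ w∈ → let s≤w , w≤u = ∈-interval⁻ w∈ in ∈-interval⁺ s≤w (≤ₚ-trans w≤u u≤t)) ,
    t , ∈-interval⁺ s≤t ≤ₚ-refl , λ t∈ → u≢t (antisym u≤t (proj₂ (∈-interval⁻ t∈)))

  interval-⊂ʳ : ∀ {s t u} → s ≤ₚ t → s ≤ₚ u → u ≢ s → interval u t ⊂ interval s t
  interval-⊂ʳ {s} {t} {u} s≤t s≤u u≢s =
    (λ w∈ → let u≤w , w≤t = ∈-interval⁻ w∈ in ∈-interval⁺ (≤ₚ-trans s≤u u≤w) w≤t) ,
    s , ∈-interval⁺ ≤ₚ-refl s≤t , λ s∈ → u≢s (antisym (proj₁ (∈-interval⁻ s∈)) s≤u)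

  StrictlyBetween : Fin N → Fin N → Fin N → Set
  StrictlyBetween s t u = s ≤ₚ u × u ≤ₚ t × u ≢ s × u ≢ t

  strictlyBetween? : ∀ s t u → Dec (StrictlyBetween s t u)
  strictlyBetween? s t u =
    (_≼?_ P) s u ×-dec (_≼?_ P) u t ×-dec ¬? (u Fin.≟ s) ×-dec ¬? (u Fin.≟ t)

  -- Grading only constrains covers: split [s,t] at an interior element and recurse on the smaller subintervals.
  ρ-strict-bounded : ∀ k {s t} → ∣ interval s t ∣ < k → s ≤ₚ t → s ≢ t → ρ P s < ρ P t
  ρ-strict-bounded (suc k) {s} {t} size s≤t s≢t with FinP.any? (strictlyBetween? s t)
  ... | no nothingBetween = ℕP.≤-reflexive (sym (ρ-cover P s t s≤t s≢t covers))
    where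
    covers : ∀ u → s ≤ₚ u → u ≤ₚ t → (u ≡ s) ⊎ (u ≡ t)
    covers u s≤u u≤t with u Fin.≟ s | u Fin.≟ t
    ... | yes u≡s | _       = inj₁ u≡s
    ... | no _    | yes u≡t = inj₂ u≡t
    ... | no u≢s  | no u≢t  = ⊥-elim (nothingBetween (u , s≤u , u≤t , u≢s , u≢t))
  ... | yes (u , s≤u , u≤t , u≢s , u≢t) =
    ℕP.<-trans (ρ-strict-bounded k (smaller (interval-⊂ˡ s≤t u≤t u≢t)) s≤u (u≢s ∘ sym))
               (ρ-strict-bounded k (smaller (interval-⊂ʳ s≤t s≤u u≢s)) u≤t u≢t)
    where
    smaller : ∀ {p} → p ⊂ interval s t → ∣ p ∣ < k
    smaller p⊂ = ℕP.<-≤-trans (p⊂q⇒∣p∣<∣q∣ p⊂) (ℕP.≤-pred size)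

  ρ-strict : ∀ {s t} → s ≤ₚ t → s ≢ t → ρ P s < ρ P t
  ρ-strict {s} {t} = ρ-strict-bounded (suc ∣ interval s t ∣) ℕP.≤-refl

  ρ-mono : ∀ {s t} → s ≤ₚ t → ρ P s ≤ ρ P t
  ρ-mono {s} {t} s≤t with s Fin.≟ t
  ... | yes refl = ℕP.≤-refl
  ... | no s≢t   = ℕP.<⇒≤ (ρ-strict s≤t s≢t)

  ρ≡0⇒bot : ∀ {u} → ρ P u ≡ 0 → u ≡ bot P
  ρ≡0⇒bot {u} ρu≡0 with u Fin.≟ bot P
  ... | yes u≡⊥ = u≡⊥
  ... | no u≢⊥  = ⊥-elim (ℕP.<-irrefl (trans (ρ-bot P) (sym ρu≡0)) (ρ-strict (bot-min P u) (u≢⊥ ∘ sym)))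

  ρ-<-top : ∀ {u} → u ≢ top P → ρ P u < ρ P (top P)
  ρ-<-top u≢⊤ = ρ-strict (top-max P _) u≢⊤

  ≤ᵇ-split : ∀ u t x → when (u ≤ᵇ t) x ≡ when (u <ᵇ t) x + when ⌊ u Fin.≟ t ⌋ x
  ≤ᵇ-split u t x with u Fin.≟ t
  ... | yes refl rewrite ≤ᵇ-true (≤ₚ-refl {u}) = sym (ℤP.+-identityˡ x)
  ... | no _ with u ≤ᵇ t
  ...   | true  = sym (ℤP.+-identityʳ x)
  ...   | false = refl

  sum-≤ᵇ-split : ∀ t (f : Fin N → ℤ) →
                 ∑[ u < N ] when (u ≤ᵇ t) (f u) ≡ ∑[ u < N ] when (u <ᵇ t) (f u) + f t
  sum-≤ᵇ-split t f = trans (sum-cong-≗ (λ u → ≤ᵇ-split u t (f u)))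
    (trans (∑-distrib-+ (λ u → when (u <ᵇ t) (f u)) (λ u → when ⌊ u Fin.≟ t ⌋ (f u)))
           (cong (λ x → ∑[ u < N ] when (u <ᵇ t) (f u) + x) (sum-when-≡ f t)))

  sum-interval-split : ∀ {s} t (f : Fin N → ℤ) → s ≤ₚ t →
                       ∑[ u < N ] when (s ≤ᵇ u ∧ u ≤ᵇ t) (f u) ≡ ∑[ u < N ] when (s ≤ᵇ u ∧ u <ᵇ t) (f u) + f t
  sum-interval-split {s} t f s≤t = begin
    ∑[ u < N ] when (s ≤ᵇ u ∧ u ≤ᵇ t) (f u)          ≡⟨ sum-cong-≗ (λ u → trans (when-∧ (s ≤ᵇ u) (u ≤ᵇ t) (f u)) (when-when (s ≤ᵇ u) (u ≤ᵇ t) (f u))) ⟩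
    ∑[ u < N ] when (u ≤ᵇ t) (when (s ≤ᵇ u) (f u))  ≡⟨ sum-≤ᵇ-split t (λ u → when (s ≤ᵇ u) (f u)) ⟩
    ∑[ u < N ] when (u <ᵇ t) (when (s ≤ᵇ u) (f u)) + when (s ≤ᵇ t) (f t)
      ≡⟨ cong₂ _+_ (sum-cong-≗ (λ u → trans (when-when (u <ᵇ t) (s ≤ᵇ u) (f u)) (sym (when-∧ (s ≤ᵇ u) (u <ᵇ t) (f u)))))
                   (cong (λ b → when b (f t)) (≤ᵇ-true s≤t)) ⟩
    ∑[ u < N ] when (s ≤ᵇ u ∧ u <ᵇ t) (f u) + f t  ∎
    where open ≡-Reasoning

  μ'-refl : ∀ fuel s → μ' P fuel s s ≡ + 1
  μ'-refl fuel s with s Fin.≟ s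
  ... | yes _ = refl
  ... | no s≢s = ⊥-elim (s≢s refl)

  μ'-unfold : ∀ fuel {s t} → s ≤ₚ t → s ≢ t →
              μ' P (suc fuel) s t ≡ - sumFin (λ u → when (s ≤ᵇ u ∧ u <ᵇ t) (μ' P fuel s u))
  μ'-unfold fuel {s} {t} s≤t s≢t with s Fin.≟ t | (_≼?_ P) s t
  ... | yes s≡t | _     = ⊥-elim (s≢t s≡t)
  ... | no _    | yes _ = refl
  ... | no _    | no s≰t = ⊥-elim (s≰t s≤t)

  μ'-fuel : ∀ f₁ f₂ {s t} → s ≤ₚ t → ρ P t ∸ ρ P s ≤ f₁ → ρ P t ∸ ρ P s ≤ f₂ → μ' P f₁ s t ≡ μ' P f₂ s t
  μ'-fuel f₁ f₂ {s} {t} s≤t = by-cases (s Fin.≟ t) f₁ f₂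
    where
    below : ∀ {u f} → s ≤ₚ u → u ≤ₚ t → u ≢ t → ρ P t ∸ ρ P s ≤ suc f → ρ P u ∸ ρ P s ≤ f
    below s≤u u≤t u≢t enough = ℕP.≤-pred (ℕP.<-≤-trans (ℕP.∸-monoˡ-< (ρ-strict u≤t u≢t) (ρ-mono s≤u)) enough)

    by-cases : Dec (s ≡ t) → ∀ f₁ f₂ → ρ P t ∸ ρ P s ≤ f₁ → ρ P t ∸ ρ P s ≤ f₂ → μ' P f₁ s t ≡ μ' P f₂ s t
    by-cases (yes refl) f₁ f₂ _ _ = trans (μ'-refl f₁ s) (sym (μ'-refl f₂ s))
    by-cases (no s≢t) zero f₂ enough _ = ⊥-elim (ℕP.<⇒≱ (ℕP.m<n⇒0<n∸m (ρ-strict s≤t s≢t)) enough)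
    by-cases (no s≢t) (suc f₁) zero _ enough = ⊥-elim (ℕP.<⇒≱ (ℕP.m<n⇒0<n∸m (ρ-strict s≤t s≢t)) enough)
    by-cases (no s≢t) (suc f₁) (suc f₂) enough₁ enough₂ =
      trans (μ'-unfold f₁ s≤t s≢t)
            (trans (cong -_ (cong (foldr _+_ (+ 0)) (ListP.map-cong (λ u → when-cong (s ≤ᵇ u ∧ u <ᵇ t) λ e →
                     let s≤u , u≤t , u≢t = ≤ᵇ∧<ᵇ-sound e
                     in μ'-fuel f₁ f₂ s≤u (below s≤u u≤t u≢t enough₁) (below s≤u u≤t u≢t enough₂)) (allFin N))))
                   (sym (μ'-unfold f₂ s≤t s≢t)))

  μ-unfold : ∀ {s t} → s ≤ₚ t → s ≢ t → μ P s t ≡ - ∑[ u < N ] when (s ≤ᵇ u ∧ u <ᵇ t) (μ P s u)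
  μ-unfold {s} {t} s≤t s≢t with ρ P t in ρt≡ | ρ-strict s≤t s≢t
  ... | zero  | ()
  ... | suc r | _ =
    trans (μ'-unfold r s≤t s≢t)
          (cong -_ (trans (sumFin≡sum (λ u → when (s ≤ᵇ u ∧ u <ᵇ t) (μ' P r s u))) (sum-cong-≗ λ u → when-cong (s ≤ᵇ u ∧ u <ᵇ t) λ e →
             let s≤u , u≤t , u≢t = ≤ᵇ∧<ᵇ-sound e
                 ρu≤r = ℕP.≤-pred (subst (ρ P u <_) ρt≡ (ρ-strict u≤t u≢t))
             in μ'-fuel r (ρ P u) s≤u (ℕP.≤-trans (ℕP.m∸n≤m (ρ P u) (ρ P s)) ρu≤r) (ℕP.m∸n≤m (ρ P u) (ρ P s)))))

  sum-μ-interval : ∀ {s t} → s ≤ₚ t → s ≢ t → ∑[ u < N ] when (s ≤ᵇ u ∧ u ≤ᵇ t) (μ P s u) ≡ + 0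
  sum-μ-interval {s} {t} s≤t s≢t =
    trans (sum-interval-split t (μ P s) s≤t)
          (trans (cong (λ x → ∑[ u < N ] when (s ≤ᵇ u ∧ u <ᵇ t) (μ P s u) + x) (μ-unfold s≤t s≢t))
                 (ℤP.+-inverseʳ (∑[ u < N ] when (s ≤ᵇ u ∧ u <ᵇ t) (μ P s u))))

  alternatingSum : Fin N → Fin N → ℤ
  alternatingSum v t = ∑[ u < N ] when (v ≤ᵇ u ∧ u ≤ᵇ t) (neg1^ (ρ P t ∸ ρ P u))

  alternatingSum-e : ∀ {v t} → v ≤ₚ t → v ≢ t →
    alternatingSum v t ≡ - (neg1^ (ρ P t ∸ ρ P v) * ∑[ u < N ] when (v ≤ᵇ u ∧ u ≤ᵇ t) (e P v u))
  alternatingSum-e {v} {t} v≤t v≢t = begin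
    alternatingSum v t                 ≡⟨ sum-cong-≗ termwise ⟩
    ∑[ u < N ] (c * (μs u - es u))     ≡⟨ sym (*-distribˡ-sum c (λ u → μs u - es u)) ⟩
    c * ∑[ u < N ] (μs u - es u)       ≡⟨ cong (c *_) (∑-distrib-- μs es) ⟩
    c * (sum μs - sum es)              ≡⟨ cong (λ x → c * (x - sum es)) (sum-μ-interval v≤t v≢t) ⟩
    c * (+ 0 - sum es)                 ≡⟨ lemma c (sum es) ⟩
    - (c * sum es)                     ∎
    where
    open ≡-Reasoning
    c = neg1^ (ρ P t ∸ ρ P v)
    μs es : Fin N → ℤ
    μs u = when (v ≤ᵇ u ∧ u ≤ᵇ t) (μ P v u)
    es u = when (v ≤ᵇ u ∧ u ≤ᵇ t) (e P v u)
    termwise : ∀ u → when (v ≤ᵇ u ∧ u ≤ᵇ t) (neg1^ (ρ P t ∸ ρ P u)) ≡ c * (μs u - es u)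
    termwise u = when-linear (v ≤ᵇ u ∧ u ≤ᵇ t) c (μ P v u) (e P v u) λ b →
      let v≤u , u≤t = ≤ᵇ∧≤ᵇ-sound b
      in trans (neg1^-∸ (ρ-mono v≤u) (ρ-mono u≤t)) (cong (c *_) (sym (μ-e (μ P v u) (neg1^ (ρ P u ∸ ρ P v)))))
      where
      μ-e : ∀ m s → m - (m - s) ≡ s
      μ-e = solve-∀
    lemma : ∀ c s → c * (+ 0 - s) ≡ - (c * s)
    lemma = solve-∀

  e-Eulerian : ∀ {s t} → IsEulerianInterval P s t → s ≤ₚ t → e P s t ≡ + 0
  e-Eulerian {s} {t} eul s≤t =
    trans (cong (_- neg1^ (ρ P t ∸ ρ P s)) (eul s t ≤ₚ-refl s≤t ≤ₚ-refl)) (ℤP.+-inverseʳ (neg1^ (ρ P t ∸ ρ P s)))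

  alternatingSum-Eulerian : ∀ {v t} → v ≤ₚ t → v ≢ t → IsEulerianInterval P v t → alternatingSum v t ≡ + 0
  alternatingSum-Eulerian {v} {t} v≤t v≢t eul = trans (alternatingSum-e v≤t v≢t)
    (trans (cong (λ x → - (neg1^ (ρ P t ∸ ρ P v) * x))
                 (sum-zero λ u → when-zero (v ≤ᵇ u ∧ u ≤ᵇ t) λ b →
                    let v≤u , u≤t = ≤ᵇ∧≤ᵇ-sound b
                    in e-Eulerian (λ w x v≤w w≤x x≤u → eul w x v≤w w≤x (≤ₚ-trans x≤u u≤t)) v≤u))
           (cong -_ (ℤP.*-zeroʳ (neg1^ (ρ P t ∸ ρ P v)))))

  ĝ : Fin N → Coeffs
  ĝ u = coeff (ghat P u)

  ĥ : Fin N → ℕ → Coeffs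
  ĥ t d k = ∑[ u < N ] when (u <ᵇ t) (([x-1]^ (d ∸ ρ P u) · ĝ u) k)

  coeff-hhat : ∀ t d → coeff (hhat P t d) ≗ ĥ t d
  coeff-hhat t d k = trans (coeff-sumPoly-allFin summand k) (sum-cong-≗ λ u → coeff-when (u <ᵇ t) u)
    where
    summand : Fin N → Poly
    summand u = if u <ᵇ t then ghat P u *ₚ (xMinus1 ^ₚ (d ∸ ρ P u)) else []
    coeff-when : ∀ b u → coeff (if b then ghat P u *ₚ (xMinus1 ^ₚ (d ∸ ρ P u)) else []) k
                         ≡ when b (([x-1]^ (d ∸ ρ P u) · ĝ u) k)
    coeff-when true  u = coeff-*ₚ-xMinus1^ (d ∸ ρ P u) (ghat P u) k
    coeff-when false u = refl

  ghat'-fuel : ∀ f₁ f₂ t → ρ P t ≤ f₁ → ρ P t ≤ f₂ → ghat' P f₁ t ≡ ghat' P f₂ t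
  ghat'-fuel f₁ f₂ t enough₁ enough₂ with ρ P t in ρt≡
  ... | zero = refl
  ... | suc d with f₁ | f₂ | enough₁ | enough₂
  ...   | suc f₁′ | suc f₂′ | s≤s enough₁′ | s≤s enough₂′ =
    cong (gFromH P d) (cong sumPoly (ListP.map-cong summand (allFin N)))
    where
    summand : ∀ u → (if u <ᵇ t then ghat' P f₁′ u *ₚ (xMinus1 ^ₚ (d ∸ ρ P u)) else [])
                  ≡ (if u <ᵇ t then ghat' P f₂′ u *ₚ (xMinus1 ^ₚ (d ∸ ρ P u)) else [])
    summand u with u <ᵇ t in u<t
    ... | false = refl
    ... | true  = cong (_*ₚ (xMinus1 ^ₚ (d ∸ ρ P u)))
                       (ghat'-fuel f₁′ f₂′ u (ℕP.≤-trans ρu≤d enough₁′) (ℕP.≤-trans ρu≤d enough₂′))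
      where
      ρu≤d : ρ P u ≤ d
      ρu≤d = let u≤t , u≢t = <ᵇ-sound u<t in ℕP.≤-pred (subst (ρ P u <_) ρt≡ (ρ-strict u≤t u≢t))

  ghat-suc : ∀ {t r} → ρ P t ≡ suc r → ghat P t ≡ gFromH P r (hhat P t r)
  ghat-suc {t} {r} ρt≡ with ρ P t in ρt≡′
  ghat-suc {t} {r} refl | suc .r = cong (gFromH P r) (cong sumPoly (ListP.map-cong summand (allFin N)))
    where
    summand : ∀ u → (if u <ᵇ t then ghat' P r u *ₚ (xMinus1 ^ₚ (r ∸ ρ P u)) else [])
                  ≡ (if u <ᵇ t then ghat P u *ₚ (xMinus1 ^ₚ (r ∸ ρ P u)) else [])
    summand u with u <ᵇ t in u<t
    ... | false = refl
    ... | true  = cong (_*ₚ (xMinus1 ^ₚ (r ∸ ρ P u))) (ghat'-fuel r (ρ P u) u ρu≤r ℕP.≤-refl)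
      where
      ρu≤r : ρ P u ≤ r
      ρu≤r = let u≤t , u≢t = <ᵇ-sound u<t in ℕP.≤-pred (subst (ρ P u <_) ρt≡′ (ρ-strict u≤t u≢t))

  ĝ-rank0 : ∀ {t} → ρ P t ≡ 0 → ĝ t ≗ δ₀
  ĝ-rank0 {t} ρt≡0 k with ρ P t
  ĝ-rank0 {t} refl zero    | zero = refl
  ĝ-rank0 {t} refl (suc k) | zero = refl

  -- lowerSum t = (x - 1) ĥ([0̂,t]), and defect t vanishes exactly when
  -- Σ_{u ≤ t} ĝ([0̂,u]) (x - 1)^(ρ t - ρ u) = x^(ρ t) ĝ([0̂,t], 1/x), as it does for Eulerian [0̂,t].
  lowerSum closedLowerSum defect : Fin N → Coeffs
  lowerSum t k = ∑[ u < N ] when (u <ᵇ t) (([x-1]^ (ρ P t ∸ ρ P u) · ĝ u) k)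
  closedLowerSum t k = ∑[ u < N ] when (u ≤ᵇ t) (([x-1]^ (ρ P t ∸ ρ P u) · ĝ u) k)
  defect t k = closedLowerSum t k - mirror (ρ P t) (ĝ t) k

  closedLowerSum≗ : ∀ t → closedLowerSum t ≗ (λ k → lowerSum t k + ĝ t k)
  closedLowerSum≗ t k = trans (sum-≤ᵇ-split t (λ u → ([x-1]^ (ρ P t ∸ ρ P u) · ĝ u) k))
                              (cong (λ m → lowerSum t k + ([x-1]^ m · ĝ t) k) (ℕP.n∸n≡0 (ρ P t)))

  lowerSum≗x-1·ĥ : ∀ {t r} → ρ P t ≡ suc r → lowerSum t ≗ x-1· ĥ t r
  lowerSum≗x-1·ĥ {t} {r} ρt≡ k = sym (trans
    (x-1·-sum (λ u k → when (u <ᵇ t) (([x-1]^ (r ∸ ρ P u) · ĝ u) k)) k)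
    (sum-cong-≗ λ u → trans (x-1·-when (u <ᵇ t) ([x-1]^ (r ∸ ρ P u) · ĝ u) k)
                            (when-cong (u <ᵇ t) λ u<t → cong (λ m → ([x-1]^ m · ĝ u) k) (exponent u<t))))
    where
    exponent : ∀ {u} → (u <ᵇ t) ≡ true → suc (r ∸ ρ P u) ≡ ρ P t ∸ ρ P u
    exponent {u} u<t = let u≤t , u≢t = <ᵇ-sound u<t in
      trans (sym (ℕP.+-∸-assoc 1 (ℕP.≤-pred (subst (ρ P u <_) ρt≡ (ρ-strict u≤t u≢t)))))
            (cong (_∸ ρ P u) (sym ρt≡))

  ĝ-low : ∀ {t r} → ρ P t ≡ suc r → ∀ k → k ≤ ⌊ r /2⌋ → ĝ t k ≡ - lowerSum t k
  ĝ-low {t} {r} ρt≡ zero _ = begin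
    ĝ t 0                       ≡⟨ cong (λ p → coeff p 0) (ghat-suc ρt≡) ⟩
    coeff (hhat P t r) 0        ≡⟨ coeff-hhat t r 0 ⟩
    ĥ t r 0                     ≡⟨ sym (ℤP.neg-involutive _) ⟩
    - (x-1· ĥ t r) 0            ≡⟨ cong -_ (sym (lowerSum≗x-1·ĥ ρt≡ 0)) ⟩
    - lowerSum t 0              ∎
    where open ≡-Reasoning
  ĝ-low {t} {r} ρt≡ (suc m) m<half = begin
    ĝ t (suc m)                                   ≡⟨ cong (λ p → coeff p (suc m)) (ghat-suc ρt≡) ⟩
    coeff (map Δ (upTo ⌊ r /2⌋)) m                ≡⟨ coeff-map-applyUpTo-< Δ (λ i → i) ⌊ r /2⌋ m m<half ⟩
    coeff (hhat P t r) (suc m) - coeff (hhat P t r) m ≡⟨ cong₂ _-_ (coeff-hhat t r (suc m)) (coeff-hhat t r m) ⟩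
    ĥ t r (suc m) - ĥ t r m                        ≡⟨ lemma (ĥ t r m) (ĥ t r (suc m)) ⟩
    - (x-1· ĥ t r) (suc m)                        ≡⟨ cong -_ (sym (lowerSum≗x-1·ĥ ρt≡ (suc m))) ⟩
    - lowerSum t (suc m)                          ∎
    where
    open ≡-Reasoning
    Δ : ℕ → ℤ
    Δ m = coeff (hhat P t r) (suc m) - coeff (hhat P t r) m
    lemma : ∀ a b → b - a ≡ - (a - b)
    lemma = solve-∀

  ĝ-high : ∀ {t r} → ρ P t ≡ suc r → ∀ k → ⌊ r /2⌋ < k → ĝ t k ≡ + 0
  ĝ-high {t} {r} ρt≡ (suc m) (s≤s half≤m) = trans (cong (λ p → coeff p (suc m)) (ghat-suc ρt≡))
    (coeff-map-applyUpTo-≥ (λ m → coeff (hhat P t r) (suc m) - coeff (hhat P t r) m) (λ i → i) ⌊ r /2⌋ m half≤m)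

  ĝ-degree : ∀ u → DegreeAtMost (ρ P u) (ĝ u)
  ĝ-degree u = by-rank (ρ P u) refl
    where
    by-rank : ∀ r → ρ P u ≡ r → DegreeAtMost r (ĝ u)
    by-rank zero    ρu≡0 (suc k) _    = ĝ-rank0 ρu≡0 (suc k)
    by-rank (suc r) ρu≡  k       r<k  = ĝ-high ρu≡ k (ℕP.≤-<-trans (ℕP.⌊n/2⌋≤n r) (ℕP.<-trans (ℕP.n<1+n r) r<k))

  lowerSum-degree : ∀ t → DegreeAtMost (ρ P t) (lowerSum t)
  lowerSum-degree t k ρt<k = sum-zero λ u → when-zero (u <ᵇ t) λ u<t →
    let u≤t , _ = <ᵇ-sound u<t in
    [x-1]^-degree (ρ P t ∸ ρ P u) (ĝ-degree u) k (subst (_< k) (sym (ℕP.m∸n+n≡m (ρ-mono u≤t))) ρt<k)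

  ĝ-rank1 : ∀ {v} → ρ P v ≡ 1 → ĝ v ≗ δ₀
  ĝ-rank1 {v} ρv≡1 (suc k) = ĝ-high ρv≡1 (suc k) (s≤s z≤n)
  ĝ-rank1 {v} ρv≡1 zero    = trans (ĝ-low ρv≡1 0 z≤n) (cong -_ lowerSum-at-0)
    where
    ⊥<v : (bot P <ᵇ v) ≡ true
    ⊥<v = <ᵇ-true (bot-min P v) λ ⊥≡v → ℕP.0≢1+n (trans (sym (ρ-bot P)) (trans (cong (ρ P) ⊥≡v) ρv≡1))
    only-⊥ : ∀ u → u ≢ bot P → when (u <ᵇ v) (([x-1]^ (ρ P v ∸ ρ P u) · ĝ u) 0) ≡ + 0
    only-⊥ u u≢⊥ = when-zero (u <ᵇ v) λ u<v → let u≤v , u≢v = <ᵇ-sound u<v in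
      ⊥-elim (u≢⊥ (ρ≡0⇒bot (ℕP.n<1⇒n≡0 (subst (ρ P u <_) ρv≡1 (ρ-strict u≤v u≢v)))))
    lowerSum-at-0 : lowerSum v 0 ≡ - + 1
    lowerSum-at-0 = begin
      lowerSum v 0                                              ≡⟨ sum-single _ (bot P) only-⊥ ⟩
      when (bot P <ᵇ v) (([x-1]^ (ρ P v ∸ ρ P (bot P)) · ĝ (bot P)) 0) ≡⟨ cong (λ b → when b (([x-1]^ (ρ P v ∸ ρ P (bot P)) · ĝ (bot P)) 0)) ⊥<v ⟩
      ([x-1]^ (ρ P v ∸ ρ P (bot P)) · ĝ (bot P)) 0             ≡⟨ cong (λ m → ([x-1]^ m · ĝ (bot P)) 0) (cong₂ _∸_ ρv≡1 (ρ-bot P)) ⟩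
      - ĝ (bot P) 0                                             ≡⟨ cong -_ (ĝ-rank0 (ρ-bot P) 0) ⟩
      - + 1                                                     ∎
      where open ≡-Reasoning

  defect-low : ∀ {u r} → ρ P u ≡ suc r → ∀ k → k ≤ ⌊ r /2⌋ → defect u k ≡ + 0
  defect-low {u} {r} ρu≡ k k≤half = begin
    closedLowerSum u k - mirror (ρ P u) (ĝ u) k
      ≡⟨ cong₂ _-_ (closedLowerSum≗ u k) (cong (λ m → mirror m (ĝ u) k) ρu≡) ⟩
    lowerSum u k + ĝ u k - mirror (suc r) (ĝ u) k
      ≡⟨ cong (λ x → lowerSum u k + ĝ u k - x) (mirror-≤ (ĝ u) (ℕP.≤-trans k≤half (ℕP.≤-trans (ℕP.⌊n/2⌋≤n r) (ℕP.n≤1+n r)))) ⟩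
    lowerSum u k + ĝ u k - ĝ u (suc r ∸ k)
      ≡⟨ cong₂ (λ a b → lowerSum u k + a - b) (ĝ-low ρu≡ k k≤half) (ĝ-high ρu≡ (suc r ∸ k) (low⇒mirror-high r k≤half)) ⟩
    lowerSum u k + - lowerSum u k - + 0
      ≡⟨ lemma (lowerSum u k) ⟩
    + 0 ∎
    where
    open ≡-Reasoning
    lemma : ∀ a → a + - a - + 0 ≡ + 0
    lemma = solve-∀

  strictAlternatingSum : ∀ v t →
    ∑[ u < N ] when (v ≤ᵇ u ∧ u <ᵇ t) (neg1^ (ρ P t ∸ ρ P u)) ≡ when (v <ᵇ t) (alternatingSum v t - + 1)
  strictAlternatingSum v t with (_≼?_ P) v t | v Fin.≟ t
  ... | no v≰t | _ = sum-zero λ u → when-zero (v ≤ᵇ u ∧ u <ᵇ t) λ b →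
    let v≤u , u≤t , _ = ≤ᵇ∧<ᵇ-sound b in ⊥-elim (v≰t (≤ₚ-trans v≤u u≤t))
  ... | yes _ | yes refl = sum-zero λ u → when-zero (v ≤ᵇ u ∧ u <ᵇ v) λ b →
    let v≤u , u≤v , u≢v = ≤ᵇ∧<ᵇ-sound b in ⊥-elim (u≢v (antisym u≤v v≤u))
  ... | yes v≤t | no v≢t =
    move (trans (sum-interval-split t (λ u → neg1^ (ρ P t ∸ ρ P u)) v≤t)
                (cong (λ m → ∑[ u < N ] when (v ≤ᵇ u ∧ u <ᵇ t) (neg1^ (ρ P t ∸ ρ P u)) + neg1^ m) (ℕP.n∸n≡0 (ρ P t))))
    where
    move : ∀ {a b} → a ≡ b + + 1 → b ≡ a - + 1
    move {b = b} refl = lemma b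
      where
      lemma : ∀ b → b ≡ b + + 1 - + 1
      lemma = solve-∀

  sum-closedLowerSum : ∀ t k →
    ∑[ u < N ] when (u <ᵇ t) (neg1^ (ρ P t ∸ ρ P u) * ([x-1]^ (ρ P t ∸ ρ P u) · closedLowerSum u) k)
    ≡ ∑[ v < N ] when (v <ᵇ t) (alternatingSum v t * ([x-1]^ (ρ P t ∸ ρ P v) · ĝ v) k) - lowerSum t k
  sum-closedLowerSum t k = begin
    ∑[ u < N ] when (u <ᵇ t) (s u * ([x-1]^ (ρ P t ∸ ρ P u) · closedLowerSum u) k)
      ≡⟨ sum-cong-≗ expand ⟩
    ∑[ u < N ] ∑[ v < N ] when (v ≤ᵇ u ∧ u <ᵇ t) (s u * W v)
      ≡⟨ ∑-comm (λ u v → when (v ≤ᵇ u ∧ u <ᵇ t) (s u * W v)) ⟩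
    ∑[ v < N ] ∑[ u < N ] when (v ≤ᵇ u ∧ u <ᵇ t) (s u * W v)
      ≡⟨ sum-cong-≗ collect ⟩
    ∑[ v < N ] (when (v <ᵇ t) (alternatingSum v t * W v) - when (v <ᵇ t) (W v))
      ≡⟨ ∑-distrib-- (λ v → when (v <ᵇ t) (alternatingSum v t * W v)) (λ v → when (v <ᵇ t) (W v)) ⟩
    ∑[ v < N ] when (v <ᵇ t) (alternatingSum v t * W v) - lowerSum t k ∎
    where
    open ≡-Reasoning
    s W : Fin N → ℤ
    s u = neg1^ (ρ P t ∸ ρ P u)
    W v = ([x-1]^ (ρ P t ∸ ρ P v) · ĝ v) k

    expand : ∀ u → when (u <ᵇ t) (s u * ([x-1]^ (ρ P t ∸ ρ P u) · closedLowerSum u) k)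
                   ≡ ∑[ v < N ] when (v ≤ᵇ u ∧ u <ᵇ t) (s u * W v)
    expand u = begin
      when (u <ᵇ t) (s u * ([x-1]^ m · closedLowerSum u) k)
        ≡⟨ cong (λ x → when (u <ᵇ t) (s u * x))
                (trans ([x-1]^-sum m (λ v k → when (v ≤ᵇ u) (([x-1]^ (ρ P u ∸ ρ P v) · ĝ v) k)) k)
                       (sum-cong-≗ λ v → [x-1]^-when m (v ≤ᵇ u) ([x-1]^ (ρ P u ∸ ρ P v) · ĝ v) k)) ⟩
      when (u <ᵇ t) (s u * ∑[ v < N ] when (v ≤ᵇ u) (X v))
        ≡⟨ cong (when (u <ᵇ t)) (*-distribˡ-sum (s u) (λ v → when (v ≤ᵇ u) (X v))) ⟩
      when (u <ᵇ t) (∑[ v < N ] (s u * when (v ≤ᵇ u) (X v)))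
        ≡⟨ when-sum (u <ᵇ t) (λ v → s u * when (v ≤ᵇ u) (X v)) ⟩
      ∑[ v < N ] when (u <ᵇ t) (s u * when (v ≤ᵇ u) (X v))
        ≡⟨ sum-cong-≗ (λ v → trans (when-*-when (u <ᵇ t) (v ≤ᵇ u) (s u) (X v))
                                   (when-cong (v ≤ᵇ u ∧ u <ᵇ t) λ b → cong (s u *_) (compose v b))) ⟩
      ∑[ v < N ] when (v ≤ᵇ u ∧ u <ᵇ t) (s u * W v) ∎
      where
      m = ρ P t ∸ ρ P u
      X : Fin N → ℤ
      X v = ([x-1]^ m · [x-1]^ (ρ P u ∸ ρ P v) · ĝ v) k
      compose : ∀ v → (v ≤ᵇ u ∧ u <ᵇ t) ≡ true → X v ≡ W v
      compose v b = let v≤u , u≤t , _ = ≤ᵇ∧<ᵇ-sound b in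
        trans (cong (λ f → f k) ([x-1]^-+ m (ρ P u ∸ ρ P v) (ĝ v)))
              (cong (λ e → ([x-1]^ e · ĝ v) k) (∸-telescope (ρ-mono v≤u) (ρ-mono u≤t)))

    collect : ∀ v → ∑[ u < N ] when (v ≤ᵇ u ∧ u <ᵇ t) (s u * W v)
                    ≡ when (v <ᵇ t) (alternatingSum v t * W v) - when (v <ᵇ t) (W v)
    collect v = begin
      ∑[ u < N ] when (v ≤ᵇ u ∧ u <ᵇ t) (s u * W v)   ≡⟨ sum-cong-≗ (λ u → when-* (v ≤ᵇ u ∧ u <ᵇ t) (s u) (W v)) ⟩
      ∑[ u < N ] (when (v ≤ᵇ u ∧ u <ᵇ t) (s u) * W v) ≡⟨ *-distribʳ-sum (λ u → when (v ≤ᵇ u ∧ u <ᵇ t) (s u)) (W v) ⟩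
      ∑[ u < N ] when (v ≤ᵇ u ∧ u <ᵇ t) (s u) * W v   ≡⟨ cong (_* W v) (strictAlternatingSum v t) ⟩
      when (v <ᵇ t) (alternatingSum v t - + 1) * W v  ≡⟨ distribute (v <ᵇ t) ⟩
      when (v <ᵇ t) (alternatingSum v t * W v) - when (v <ᵇ t) (W v) ∎
      where
      distribute : ∀ b → when b (alternatingSum v t - + 1) * W v ≡ when b (alternatingSum v t * W v) - when b (W v)
      distribute true  = lemma (alternatingSum v t) (W v)
        where
        lemma : ∀ a w → (a - + 1) * w ≡ a * w - w
        lemma = solve-∀
      distribute false = refl

  lowerSum-reflection : ∀ t k →
    mirror (ρ P t) (lowerSum t) k + lowerSum t k
    ≡ ∑[ v < N ] when (v <ᵇ t) (alternatingSum v t * ([x-1]^ (ρ P t ∸ ρ P v) · ĝ v) k)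
      - ∑[ u < N ] when (u <ᵇ t) (neg1^ (ρ P t ∸ ρ P u) * ([x-1]^ (ρ P t ∸ ρ P u) · defect u) k)
  lowerSum-reflection t k = begin
    mirror r (lowerSum t) k + lowerSum t k
      ≡⟨ cong (_+ lowerSum t k) (mirror-sum r (λ u k → when (u <ᵇ t) (([x-1]^ (m u) · ĝ u) k)) k) ⟩
    ∑[ u < N ] mirror r (λ k → when (u <ᵇ t) (([x-1]^ (m u) · ĝ u) k)) k + lowerSum t k
      ≡⟨ cong (_+ lowerSum t k) (sum-cong-≗ termwise) ⟩
    ∑[ u < N ] (closedPart u - defectPart u) + lowerSum t k
      ≡⟨ cong (_+ lowerSum t k) (∑-distrib-- closedPart defectPart) ⟩
    sum closedPart - sum defectPart + lowerSum t k
      ≡⟨ cong (λ x → x - sum defectPart + lowerSum t k) (sum-closedLowerSum t k) ⟩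
    alternatingPart - lowerSum t k - sum defectPart + lowerSum t k
      ≡⟨ lemma alternatingPart (sum defectPart) (lowerSum t k) ⟩
    alternatingPart - sum defectPart ∎
    where
    open ≡-Reasoning
    r = ρ P t
    m : Fin N → ℕ
    m u = r ∸ ρ P u
    closedPart defectPart : Fin N → ℤ
    closedPart u = when (u <ᵇ t) (neg1^ (m u) * ([x-1]^ (m u) · closedLowerSum u) k)
    defectPart u = when (u <ᵇ t) (neg1^ (m u) * ([x-1]^ (m u) · defect u) k)
    alternatingPart = ∑[ v < N ] when (v <ᵇ t) (alternatingSum v t * ([x-1]^ (m v) · ĝ v) k)

    termwise : ∀ u → mirror r (λ k → when (u <ᵇ t) (([x-1]^ (m u) · ĝ u) k)) k ≡ closedPart u - defectPart u
    termwise u = trans (mirror-when r (u <ᵇ t) ([x-1]^ (m u) · ĝ u) k)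
      (trans (when-cong (u <ᵇ t) λ u<t → let u≤t , _ = <ᵇ-sound u<t in begin
        mirror r ([x-1]^ (m u) · ĝ u) k
          ≡⟨ cong (λ n → mirror n ([x-1]^ (m u) · ĝ u) k) (sym (ℕP.m∸n+n≡m (ρ-mono u≤t))) ⟩
        mirror (m u ℕ.+ ρ P u) ([x-1]^ (m u) · ĝ u) k
          ≡⟨ mirror-[x-1]^ (m u) (ĝ-degree u) k ⟩
        neg1^ (m u) * ([x-1]^ (m u) · mirror (ρ P u) (ĝ u)) k
          ≡⟨ cong (neg1^ (m u) *_) ([x-1]^-cong (m u) (λ k → sym (undo (closedLowerSum u k) (mirror (ρ P u) (ĝ u) k))) k) ⟩
        neg1^ (m u) * ([x-1]^ (m u) · (λ k → closedLowerSum u k - defect u k)) k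
          ≡⟨ cong (neg1^ (m u) *_) ([x-1]^-- (m u) (closedLowerSum u) (defect u) k) ⟩
        neg1^ (m u) * (([x-1]^ (m u) · closedLowerSum u) k - ([x-1]^ (m u) · defect u) k)
          ≡⟨ distrib (neg1^ (m u)) _ _ ⟩
        neg1^ (m u) * ([x-1]^ (m u) · closedLowerSum u) k - neg1^ (m u) * ([x-1]^ (m u) · defect u) k ∎)
      (when-- (u <ᵇ t) _ _))
      where
      undo : ∀ a b → a - (a - b) ≡ b
      undo = solve-∀
      distrib : ∀ c y z → c * (y - z) ≡ c * y - c * z
      distrib = solve-∀

    lemma : ∀ x y d → x - d - y + d ≡ x - y
    lemma = solve-∀

  defect-rank0 : ∀ {t} → ρ P t ≡ 0 → defect t ≗ (λ _ → + 0)
  defect-rank0 {t} ρt≡0 k = begin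
    closedLowerSum t k - mirror (ρ P t) (ĝ t) k
      ≡⟨ cong₂ _-_ (closedLowerSum≗ t k) (cong (λ n → mirror n (ĝ t) k) ρt≡0) ⟩
    lowerSum t k + ĝ t k - mirror 0 (ĝ t) k
      ≡⟨ cong₂ (λ a b → a + ĝ t k - b) nothing-below (mirror-cong 0 (ĝ-rank0 ρt≡0) k) ⟩
    + 0 + ĝ t k - mirror 0 δ₀ k
      ≡⟨ cong (λ x → + 0 + x - mirror 0 δ₀ k) (ĝ-rank0 ρt≡0 k) ⟩
    + 0 + δ₀ k - mirror 0 δ₀ k
      ≡⟨ cancel k ⟩
    + 0 ∎
    where
    open ≡-Reasoning
    nothing-below : lowerSum t k ≡ + 0
    nothing-below = sum-zero λ u → when-zero (u <ᵇ t) λ u<t → let u≤t , u≢t = <ᵇ-sound u<t in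
      ⊥-elim (ℕP.n≮0 (subst (ρ P u <_) ρt≡0 (ρ-strict u≤t u≢t)))
    cancel : ∀ k → + 0 + δ₀ k - mirror 0 δ₀ k ≡ + 0
    cancel zero    = refl
    cancel (suc k) = refl

  antipalindromic⇒defect≡0 : ∀ {t r} → ρ P t ≡ suc r →
    (∀ k → mirror (ρ P t) (lowerSum t) k + lowerSum t k ≡ + 0) → defect t ≗ (λ _ → + 0)
  antipalindromic⇒defect≡0 {t} {r} ρt≡ anti k =
    trans (cong₂ _-_ (closedLowerSum≗ t k) (cong (λ n → mirror n (ĝ t) k) ρt≡))
          (truncation-palindromic r (lowerSum t) (ĝ t) (subst (λ n → DegreeAtMost n (lowerSum t)) ρt≡ (lowerSum-degree t))
             mirrored (ĝ-low ρt≡) (ĝ-high ρt≡) k)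
    where
    mirrored : ∀ k → k ≤ suc r → lowerSum t (suc r ∸ k) ≡ - lowerSum t k
    mirrored k k≤ = inverseˡ-unique (lowerSum t (suc r ∸ k)) (lowerSum t k)
      (trans (cong (_+ lowerSum t k) (sym (trans (cong (λ n → mirror n (lowerSum t) k) ρt≡) (mirror-≤ (lowerSum t) k≤))))
             (anti k))

  module _ {d} (oneSing : OneSing P d) where

    lowerSum-antipalindromic : ∀ {t} → suc (ρ P t) ≤ d → (∀ u → (u <ᵇ t) ≡ true → defect u ≗ (λ _ → + 0)) →
                               ∀ k → mirror (ρ P t) (lowerSum t) k + lowerSum t k ≡ + 0
    lowerSum-antipalindromic {t} small defect-below k =
      trans (lowerSum-reflection t k) (cong₂ _-_ alternating-vanishes defects-vanish)
      where
      alternating-vanishes : ∑[ v < N ] when (v <ᵇ t) (alternatingSum v t * ([x-1]^ (ρ P t ∸ ρ P v) · ĝ v) k) ≡ + 0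
      alternating-vanishes = sum-zero λ v → when-zero (v <ᵇ t) λ v<t → let v≤t , v≢t = <ᵇ-sound v<t in
        trans (cong (_* ([x-1]^ (ρ P t ∸ ρ P v) · ĝ v) k)
                    (alternatingSum-Eulerian v≤t v≢t
                       (oneSing v t v≤t (ℕP.≤-trans (s≤s (ℕP.m∸n≤m (ρ P t) (ρ P v))) small))))
              (ℤP.*-zeroˡ (([x-1]^ (ρ P t ∸ ρ P v) · ĝ v) k))
      defects-vanish : ∑[ u < N ] when (u <ᵇ t) (neg1^ (ρ P t ∸ ρ P u) * ([x-1]^ (ρ P t ∸ ρ P u) · defect u) k) ≡ + 0
      defects-vanish = sum-zero λ u → when-zero (u <ᵇ t) λ u<t →
        trans (cong (neg1^ (ρ P t ∸ ρ P u) *_)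
                    (trans ([x-1]^-cong (ρ P t ∸ ρ P u) (defect-below u u<t) k) ([x-1]^-zero (ρ P t ∸ ρ P u) k)))
              (ℤP.*-zeroʳ (neg1^ (ρ P t ∸ ρ P u)))

    defect-vanishes : ∀ t → suc (ρ P t) ≤ d → defect t ≗ (λ _ → + 0)
    defect-vanishes t = by-fuel (suc (ρ P t)) t ℕP.≤-refl
      where
      by-fuel : ∀ m t → ρ P t < m → suc (ρ P t) ≤ d → defect t ≗ (λ _ → + 0)
      by-fuel (suc m) t ρt<m small = by-rank (ρ P t) refl
        where
        defect-below : ∀ u → (u <ᵇ t) ≡ true → defect u ≗ (λ _ → + 0)
        defect-below u u<t = let u≤t , u≢t = <ᵇ-sound u<t ; ρu<ρt = ρ-strict u≤t u≢t in
          by-fuel m u (ℕP.<-≤-trans ρu<ρt (ℕP.≤-pred ρt<m)) (ℕP.≤-trans (ℕP.m≤n⇒m≤1+n ρu<ρt) small)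
        by-rank : ∀ r → ρ P t ≡ r → defect t ≗ (λ _ → + 0)
        by-rank zero    ρt≡0 = defect-rank0 ρt≡0
        by-rank (suc r) ρt≡  = antipalindromic⇒defect≡0 ρt≡ (lowerSum-antipalindromic small defect-below)

  -- Here d is one less than the d of the theorem.

  module TopRank {d} (ρ⊤≡ : ρ P (top P) ≡ suc (suc d)) (oneSing : OneSing P (suc d)) where

    private
      ⊤ ⊥ : Fin N
      ⊤ = top P
      ⊥ = bot P

    ⊥≢⊤ : ⊥ ≢ ⊤
    ⊥≢⊤ ⊥≡⊤ = ℕP.0≢1+n (trans (sym (ρ-bot P)) (trans (cong (ρ P) ⊥≡⊤) ρ⊤≡))

    ρ≢⇒≢⊤ : ∀ {v} → ρ P v ≢ suc (suc d) → v ≢ ⊤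
    ρ≢⇒≢⊤ ρv≢ v≡⊤ = ρv≢ (trans (cong (ρ P) v≡⊤) ρ⊤≡)

    ρ≤1+d : ∀ {v} → v ≢ ⊤ → ρ P v ≤ suc d
    ρ≤1+d {v} v≢⊤ = ℕP.≤-pred (subst (ρ P v <_) ρ⊤≡ (ρ-<-top v≢⊤))

    ρ<⊤⇒Eulerian : ∀ {v u} → v ≤ₚ u → suc (ρ P u ∸ ρ P v) ≤ suc d → e P v u ≡ + 0
    ρ<⊤⇒Eulerian v≤u short = e-Eulerian (oneSing _ _ v≤u short) v≤u

    A B : Coeffs
    A = [x-1]^ suc d · δ₀
    B = [x-1]^ d · δ₀

    alternatingTerm-split : ∀ v k →
      when (v <ᵇ ⊤) (alternatingSum v ⊤ * ([x-1]^ (ρ P ⊤ ∸ ρ P v) · ĝ v) k)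
      ≡ when ⌊ v Fin.≟ ⊥ ⌋ (alternatingSum v ⊤ * (x-1· A) k) + when ⌊ ρ P v ℕ.≟ 1 ⌋ (alternatingSum v ⊤ * (x-1· B) k)
    alternatingTerm-split v k = by-cases (v Fin.≟ ⊥) (ρ P v ℕ.≟ 1)
      where
      lhs = when (v <ᵇ ⊤) (alternatingSum v ⊤ * ([x-1]^ (ρ P ⊤ ∸ ρ P v) · ĝ v) k)
      by-cases : (q : Dec (v ≡ ⊥)) (q₁ : Dec (ρ P v ≡ 1)) →
                 lhs ≡ when ⌊ q ⌋ (alternatingSum v ⊤ * (x-1· A) k) + when ⌊ q₁ ⌋ (alternatingSum v ⊤ * (x-1· B) k)
      by-cases (yes refl) q₁ = begin
        lhs ≡⟨ cong (λ b → when b (alternatingSum ⊥ ⊤ * ([x-1]^ (ρ P ⊤ ∸ ρ P ⊥) · ĝ ⊥) k)) (<ᵇ-true (bot-min P ⊤) ⊥≢⊤) ⟩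
        alternatingSum ⊥ ⊤ * ([x-1]^ (ρ P ⊤ ∸ ρ P ⊥) · ĝ ⊥) k
          ≡⟨ cong (alternatingSum ⊥ ⊤ *_) (trans (cong (λ m → ([x-1]^ m · ĝ ⊥) k) (cong₂ _∸_ ρ⊤≡ (ρ-bot P)))
                                                 ([x-1]^-cong (suc (suc d)) (ĝ-rank0 (ρ-bot P)) k)) ⟩
        alternatingSum ⊥ ⊤ * (x-1· A) k
          ≡⟨ sym (ℤP.+-identityʳ _) ⟩
        alternatingSum ⊥ ⊤ * (x-1· A) k + + 0
          ≡⟨ cong (λ x → alternatingSum ⊥ ⊤ * (x-1· A) k + x)
                  (sym (when-false q₁ λ ρ⊥≡1 → ℕP.0≢1+n (trans (sym (ρ-bot P)) ρ⊥≡1))) ⟩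
        alternatingSum ⊥ ⊤ * (x-1· A) k + when ⌊ q₁ ⌋ (alternatingSum ⊥ ⊤ * (x-1· B) k) ∎
        where open ≡-Reasoning
      by-cases (no v≢⊥) (yes ρv≡1) = begin
        lhs ≡⟨ cong (λ b → when b (alternatingSum v ⊤ * ([x-1]^ (ρ P ⊤ ∸ ρ P v) · ĝ v) k))
                    (<ᵇ-true (top-max P v) (ρ≢⇒≢⊤ λ ρv≡ → ℕP.0≢1+n (ℕP.suc-injective (trans (sym ρv≡1) ρv≡)))) ⟩
        alternatingSum v ⊤ * ([x-1]^ (ρ P ⊤ ∸ ρ P v) · ĝ v) k
          ≡⟨ cong (alternatingSum v ⊤ *_) (trans (cong (λ m → ([x-1]^ m · ĝ v) k) (cong₂ _∸_ ρ⊤≡ ρv≡1))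
                                                 ([x-1]^-cong (suc d) (ĝ-rank1 ρv≡1) k)) ⟩
        alternatingSum v ⊤ * (x-1· B) k
          ≡⟨ sym (ℤP.+-identityˡ _) ⟩
        + 0 + alternatingSum v ⊤ * (x-1· B) k ∎
        where open ≡-Reasoning
      by-cases (no v≢⊥) (no ρv≢1) = when-zero (v <ᵇ ⊤) λ v<⊤ → let v≤⊤ , v≢⊤ = <ᵇ-sound v<⊤ in
        trans (cong (_* ([x-1]^ (ρ P ⊤ ∸ ρ P v) · ĝ v) k) (alternatingSum-Eulerian v≤⊤ v≢⊤ (oneSing v ⊤ v≤⊤ short)))
              (ℤP.*-zeroˡ (([x-1]^ (ρ P ⊤ ∸ ρ P v) · ĝ v) k))
        where
        2≤ρv : 2 ≤ ρ P v
        2≤ρv with ρ P v in ρv≡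
        ... | zero        = ⊥-elim (v≢⊥ (ρ≡0⇒bot ρv≡))
        ... | suc zero    = ⊥-elim (ρv≢1 refl)
        ... | suc (suc _) = s≤s (s≤s z≤n)
        short : suc (ρ P ⊤ ∸ ρ P v) ≤ suc d
        short = s≤s (subst (λ m → m ∸ ρ P v ≤ d) (sym ρ⊤≡) (ℕP.∸-monoʳ-≤ (suc (suc d)) 2≤ρv))

    defectTerm-split : ∀ u k →
      when (u <ᵇ ⊤) (neg1^ (ρ P ⊤ ∸ ρ P u) * ([x-1]^ (ρ P ⊤ ∸ ρ P u) · defect u) k)
      ≡ - when ⌊ ρ P u ℕ.≟ suc d ⌋ ((x-1· defect u) k)
    defectTerm-split u k with ρ P u ℕ.≟ suc d
    ... | yes ρu≡ = begin
      when (u <ᵇ ⊤) (neg1^ (ρ P ⊤ ∸ ρ P u) * ([x-1]^ (ρ P ⊤ ∸ ρ P u) · defect u) k)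
        ≡⟨ cong (λ b → when b (neg1^ (ρ P ⊤ ∸ ρ P u) * ([x-1]^ (ρ P ⊤ ∸ ρ P u) · defect u) k))
                (<ᵇ-true (top-max P u) (ρ≢⇒≢⊤ λ ρu≡′ → ℕP.<-irrefl (trans (sym ρu≡) ρu≡′) (ℕP.n<1+n (suc d)))) ⟩
      neg1^ (ρ P ⊤ ∸ ρ P u) * ([x-1]^ (ρ P ⊤ ∸ ρ P u) · defect u) k
        ≡⟨ cong (λ m → neg1^ m * ([x-1]^ m · defect u) k) (trans (cong₂ _∸_ ρ⊤≡ ρu≡) (ℕP.m+n∸n≡m 1 (suc d))) ⟩
      neg1^ 1 * (x-1· defect u) k
        ≡⟨ ℤP.-1*i≡-i _ ⟩
      - (x-1· defect u) k ∎
      where open ≡-Reasoning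
    ... | no ρu≢ = when-zero (u <ᵇ ⊤) λ u<⊤ → let u≤⊤ , u≢⊤ = <ᵇ-sound u<⊤ in
      trans (cong (neg1^ (ρ P ⊤ ∸ ρ P u) *_)
                  (trans ([x-1]^-cong (ρ P ⊤ ∸ ρ P u) (defect-vanishes oneSing u (below-1+d u≢⊤)) k)
                         ([x-1]^-zero (ρ P ⊤ ∸ ρ P u) k)))
            (ℤP.*-zeroʳ (neg1^ (ρ P ⊤ ∸ ρ P u)))
      where
      below-1+d : u ≢ ⊤ → suc (ρ P u) ≤ suc d
      below-1+d u≢⊤ with ℕP.m≤n⇒m<n∨m≡n (ρ≤1+d u≢⊤)
      ... | inj₁ ρu<1+d = ρu<1+d
      ... | inj₂ ρu≡    = ⊥-elim (ρu≢ ρu≡)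

    ĥ⊤ : Coeffs
    ĥ⊤ = ĥ ⊤ (suc d)

    S₁ S₂ Z : Coeffs
    S₁ k = ∑[ v < N ] when ⌊ ρ P v ℕ.≟ 1 ⌋ (alternatingSum v ⊤ * B k)
    S₂ k = ∑[ u < N ] when ⌊ ρ P u ℕ.≟ suc d ⌋ (defect u k)
    Z k = alternatingSum ⊥ ⊤ * A k + S₁ k + S₂ k

    reflection-rhs : ∀ k →
      ∑[ v < N ] when (v <ᵇ ⊤) (alternatingSum v ⊤ * ([x-1]^ (ρ P ⊤ ∸ ρ P v) · ĝ v) k)
      - ∑[ u < N ] when (u <ᵇ ⊤) (neg1^ (ρ P ⊤ ∸ ρ P u) * ([x-1]^ (ρ P ⊤ ∸ ρ P u) · defect u) k)
      ≡ (x-1· Z) k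
    reflection-rhs k = begin
      ∑[ v < N ] when (v <ᵇ ⊤) (alternatingSum v ⊤ * ([x-1]^ (ρ P ⊤ ∸ ρ P v) · ĝ v) k)
      - ∑[ u < N ] when (u <ᵇ ⊤) (neg1^ (ρ P ⊤ ∸ ρ P u) * ([x-1]^ (ρ P ⊤ ∸ ρ P u) · defect u) k)
        ≡⟨ cong₂ _-_ (trans (sum-cong-≗ (λ v → alternatingTerm-split v k)) (∑-distrib-+ atBottom atRank1))
                     (trans (sum-cong-≗ (λ u → defectTerm-split u k)) (∑-distrib-neg atCorank1)) ⟩
      sum atBottom + sum atRank1 - - sum atCorank1
        ≡⟨ cong (λ x → x + sum atRank1 - - sum atCorank1) (sum-when-≡ (λ v → alternatingSum v ⊤ * (x-1· A) k) ⊥) ⟩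
      alternatingSum ⊥ ⊤ * (x-1· A) k + sum atRank1 - - sum atCorank1
        ≡⟨ lemma (alternatingSum ⊥ ⊤ * (x-1· A) k) (sum atRank1) (sum atCorank1) ⟩
      alternatingSum ⊥ ⊤ * (x-1· A) k + sum atRank1 + sum atCorank1
        ≡⟨ sym (cong₂ _+_ (trans (x-1·-+ (λ k → alternatingSum ⊥ ⊤ * A k) S₁ k)
                                  (cong₂ _+_ (x-1·-* (alternatingSum ⊥ ⊤) A k) x-1·S₁))
                          x-1·S₂) ⟩
      (x-1· (λ k → alternatingSum ⊥ ⊤ * A k + S₁ k)) k + (x-1· S₂) k
        ≡⟨ sym (x-1·-+ (λ k → alternatingSum ⊥ ⊤ * A k + S₁ k) S₂ k) ⟩
      (x-1· Z) k ∎
      where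
      open ≡-Reasoning
      atBottom atRank1 atCorank1 : Fin N → ℤ
      atBottom v = when ⌊ v Fin.≟ ⊥ ⌋ (alternatingSum v ⊤ * (x-1· A) k)
      atRank1 v = when ⌊ ρ P v ℕ.≟ 1 ⌋ (alternatingSum v ⊤ * (x-1· B) k)
      atCorank1 u = when ⌊ ρ P u ℕ.≟ suc d ⌋ ((x-1· defect u) k)
      x-1·S₁ : (x-1· S₁) k ≡ sum atRank1
      x-1·S₁ = trans (x-1·-sum (λ v k → when ⌊ ρ P v ℕ.≟ 1 ⌋ (alternatingSum v ⊤ * B k)) k)
        (sum-cong-≗ λ v → trans (x-1·-when ⌊ ρ P v ℕ.≟ 1 ⌋ (λ k → alternatingSum v ⊤ * B k) k)
                                (cong (when ⌊ ρ P v ℕ.≟ 1 ⌋) (x-1·-* (alternatingSum v ⊤) B k)))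
      x-1·S₂ : (x-1· S₂) k ≡ sum atCorank1
      x-1·S₂ = trans (x-1·-sum (λ u k → when ⌊ ρ P u ℕ.≟ suc d ⌋ (defect u k)) k)
        (sum-cong-≗ λ u → x-1·-when ⌊ ρ P u ℕ.≟ suc d ⌋ (defect u) k)
      lemma : ∀ a b c → a + b - - c ≡ a + b + c
      lemma = solve-∀

    ĥ⊤-degree : DegreeAtMost (suc d) ĥ⊤
    ĥ⊤-degree k 1+d<k = sum-zero λ u → when-zero (u <ᵇ ⊤) λ u<⊤ → let _ , u≢⊤ = <ᵇ-sound u<⊤ in
      [x-1]^-degree (suc d ∸ ρ P u) (ĝ-degree u) k (subst (_< k) (sym (ℕP.m∸n+n≡m (ρ≤1+d u≢⊤))) 1+d<k)

    reflection-lhs : ∀ k → mirror (ρ P ⊤) (lowerSum ⊤) k + lowerSum ⊤ k ≡ (x-1· (λ k → ĥ⊤ k - mirror (suc d) ĥ⊤ k)) k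
    reflection-lhs k = begin
      mirror (ρ P ⊤) (lowerSum ⊤) k + lowerSum ⊤ k
        ≡⟨ cong₂ _+_ (trans (cong (λ n → mirror n (lowerSum ⊤) k) ρ⊤≡) (mirror-cong (suc (suc d)) (lowerSum≗x-1·ĥ ρ⊤≡) k))
                     (lowerSum≗x-1·ĥ ρ⊤≡ k) ⟩
      mirror (suc (suc d)) (x-1· ĥ⊤) k + (x-1· ĥ⊤) k
        ≡⟨ cong (_+ (x-1· ĥ⊤) k) (mirror-x-1· ĥ⊤-degree k) ⟩
      - (x-1· mirror (suc d) ĥ⊤) k + (x-1· ĥ⊤) k
        ≡⟨ ℤP.+-comm (- (x-1· mirror (suc d) ĥ⊤) k) ((x-1· ĥ⊤) k) ⟩
      (x-1· ĥ⊤) k - (x-1· mirror (suc d) ĥ⊤) k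
        ≡⟨ sym (x-1·-- ĥ⊤ (mirror (suc d) ĥ⊤) k) ⟩
      (x-1· (λ k → ĥ⊤ k - mirror (suc d) ĥ⊤ k)) k ∎
      where open ≡-Reasoning

    ĥ⊤-asymmetry : ∀ k → ĥ⊤ k - mirror (suc d) ĥ⊤ k ≡ Z k
    ĥ⊤-asymmetry = x-1·-injective λ k →
      trans (sym (reflection-lhs k)) (trans (lowerSum-reflection ⊤ k) (reflection-rhs k))

    S₂-low : ∀ k → k ≤ ⌊ d /2⌋ → S₂ k ≡ + 0
    S₂-low k k≤half = sum-zero λ u → when-zero ⌊ ρ P u ℕ.≟ suc d ⌋ λ b →
      defect-low (⌊⌋-witness (ρ P u ℕ.≟ suc d) b) k k≤half

    Σ₁ Σd : ℤ
    Σ₁ = ∑[ v < N ] when ⌊ ρ P v ℕ.≟ 1 ⌋ (e P v ⊤)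
    Σd = ∑[ u < N ] when ⌊ ρ P u ℕ.≟ suc d ⌋ (e P ⊥ u)

    alternatingSum-⊥ : alternatingSum ⊥ ⊤ ≡ - (neg1^ (suc (suc d)) * (e P ⊥ ⊤ + Σd))
    alternatingSum-⊥ = trans (alternatingSum-e (bot-min P ⊤) ⊥≢⊤)
      (cong -_ (cong₂ _*_ (cong neg1^ (cong₂ _∸_ ρ⊤≡ (ρ-bot P)))
        (trans (sum-cong-≗ split)
               (trans (∑-distrib-+ (λ u → when ⌊ u Fin.≟ ⊤ ⌋ (e P ⊥ u)) (λ u → when ⌊ ρ P u ℕ.≟ suc d ⌋ (e P ⊥ u)))
                      (cong (_+ Σd) (sum-when-≡ (e P ⊥) ⊤))))))
      where
      split : ∀ u → when (⊥ ≤ᵇ u ∧ u ≤ᵇ ⊤) (e P ⊥ u)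
                    ≡ when ⌊ u Fin.≟ ⊤ ⌋ (e P ⊥ u) + when ⌊ ρ P u ℕ.≟ suc d ⌋ (e P ⊥ u)
      split u = trans (cong (λ b → when b (e P ⊥ u)) (cong₂ _∧_ (≤ᵇ-true (bot-min P u)) (≤ᵇ-true (top-max P u))))
                      (by-cases (u Fin.≟ ⊤) (ρ P u ℕ.≟ suc d))
        where
        by-cases : (q : Dec (u ≡ ⊤)) (q₁ : Dec (ρ P u ≡ suc d)) →
                   e P ⊥ u ≡ when ⌊ q ⌋ (e P ⊥ u) + when ⌊ q₁ ⌋ (e P ⊥ u)
        by-cases (yes refl) q₁ = sym (trans (cong (λ x → e P ⊥ ⊤ + x)
          (when-false q₁ λ ρ⊤≡′ → ℕP.<-irrefl (trans (sym ρ⊤≡′) ρ⊤≡) (ℕP.n<1+n (suc d)))) (ℤP.+-identityʳ _))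
        by-cases (no _) (yes _) = sym (ℤP.+-identityˡ _)
        by-cases (no u≢⊤) (no ρu≢) = ρ<⊤⇒Eulerian (bot-min P u) short
          where
          short : suc (ρ P u ∸ ρ P ⊥) ≤ suc d
          short rewrite ρ-bot P with ℕP.m≤n⇒m<n∨m≡n (ρ≤1+d u≢⊤)
          ... | inj₁ ρu<1+d = ρu<1+d
          ... | inj₂ ρu≡    = ⊥-elim (ρu≢ ρu≡)

    alternatingSum-rank1 : ∀ {v} → ρ P v ≡ 1 → alternatingSum v ⊤ ≡ - (neg1^ (suc d) * e P v ⊤)
    alternatingSum-rank1 {v} ρv≡1 = trans (alternatingSum-e (top-max P v) v≢⊤)
      (cong -_ (cong₂ _*_ (cong neg1^ (cong₂ _∸_ ρ⊤≡ ρv≡1))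
        (trans (sum-single _ ⊤ only-⊤)
               (cong (λ b → when b (e P v ⊤)) (cong₂ _∧_ (≤ᵇ-true (top-max P v)) (≤ᵇ-true (≤ₚ-refl {⊤})))))))
      where
      v≢⊤ : v ≢ ⊤
      v≢⊤ = ρ≢⇒≢⊤ λ ρv≡ → ℕP.0≢1+n (ℕP.suc-injective (trans (sym ρv≡1) ρv≡))
      only-⊤ : ∀ u → u ≢ ⊤ → when (v ≤ᵇ u ∧ u ≤ᵇ ⊤) (e P v u) ≡ + 0
      only-⊤ u u≢⊤ = when-zero (v ≤ᵇ u ∧ u ≤ᵇ ⊤) λ b → let v≤u , _ = ≤ᵇ∧≤ᵇ-sound b in
        ρ<⊤⇒Eulerian v≤u (s≤s (subst (λ r → ρ P u ∸ r ≤ d) (sym ρv≡1) (ℕP.∸-monoˡ-≤ 1 (ρ≤1+d u≢⊤))))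

    A-at : ∀ {i} → i ≤ d → A (d ∸ i) ≡ neg1^ (suc i) * + (suc d C suc i)
    A-at {i} i≤d = trans ([x-1]^-δ₀ (suc d) (d ∸ i))
      (cong₂ (λ a b → neg1^ a * + b) (ℕP.m∸[m∸n]≡n (s≤s i≤d)) (sym (ℕC.nCk≡nC[n∸k] (s≤s i≤d))))

    B-at : ∀ {i} → i ≤ d → B (d ∸ i) ≡ neg1^ i * + (d C i)
    B-at {i} i≤d = trans ([x-1]^-δ₀ d (d ∸ i))
      (cong₂ (λ a b → neg1^ a * + b) (ℕP.m∸[m∸n]≡n i≤d) (sym (ℕC.nCk≡nC[n∸k] i≤d)))

    S₁-value : ∀ k → S₁ k ≡ (- neg1^ (suc d) * B k) * Σ₁
    S₁-value k = trans (sum-cong-≗ λ v → by-rank v ⌊ ρ P v ℕ.≟ 1 ⌋ λ b → alternatingSum-rank1 (⌊⌋-witness (ρ P v ℕ.≟ 1) b))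
                       (sym (*-distribˡ-sum (- neg1^ (suc d) * B k) (λ v → when ⌊ ρ P v ℕ.≟ 1 ⌋ (e P v ⊤))))
      where
      by-rank : ∀ v b → (b ≡ true → alternatingSum v ⊤ ≡ - (neg1^ (suc d) * e P v ⊤)) →
                when b (alternatingSum v ⊤ * B k) ≡ (- neg1^ (suc d) * B k) * when b (e P v ⊤)
      by-rank v true  h rewrite h refl = lemma (neg1^ (suc d)) (e P v ⊤) (B k)
        where
        lemma : ∀ c x w → - (c * x) * w ≡ - c * w * x
        lemma = solve-∀
      by-rank v false h = sym (ℤP.*-zeroʳ (- neg1^ (suc d) * B k))

    ĥ⊤-difference : ∀ i → ⌊ suc d /2⌋ < suc i → i ≤ d →
      ĥ⊤ (suc i) - ĥ⊤ (d ∸ i)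
      ≡ neg1^ (suc (d ∸ i)) * (+ (suc d C suc i) * e P ⊥ ⊤ + + (suc d C suc i) * Σd + + (d C i) * Σ₁)
    ĥ⊤-difference i half<1+i i≤d = begin
      ĥ⊤ (suc i) - ĥ⊤ k₀
        ≡⟨ cong (_- ĥ⊤ k₀) (sym (trans (mirror-≤ ĥ⊤ k₀≤1+d) (cong ĥ⊤ (ℕP.m∸[m∸n]≡n (s≤s i≤d))))) ⟩
      mirror (suc d) ĥ⊤ k₀ - ĥ⊤ k₀
        ≡⟨ sym (⁻¹-anti-homo‿- (ĥ⊤ k₀) (mirror (suc d) ĥ⊤ k₀)) ⟩
      - (ĥ⊤ k₀ - mirror (suc d) ĥ⊤ k₀)
        ≡⟨ cong -_ (ĥ⊤-asymmetry k₀) ⟩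
      - (alternatingSum ⊥ ⊤ * A k₀ + S₁ k₀ + S₂ k₀)
        ≡⟨ cong -_ (cong₂ _+_ (cong₂ _+_ (cong₂ _*_ alternatingSum-⊥ (A-at i≤d))
                                          (trans (S₁-value k₀) (cong (λ x → (- neg1^ (suc d) * x) * Σ₁) (B-at i≤d))))
                               (S₂-low k₀ k₀≤half)) ⟩
      - (- (neg1^ (suc (suc d)) * (e P ⊥ ⊤ + Σd)) * (neg1^ (suc i) * c₁) + (- neg1^ (suc d) * (neg1^ i * c₂)) * Σ₁ + + 0)
        ≡⟨ collect (neg1^ (suc d)) (neg1^ i) c₁ c₂ (e P ⊥ ⊤) Σd Σ₁ ⟩
      (neg1^ (suc d) * neg1^ i) * (c₁ * e P ⊥ ⊤ + c₁ * Σd + c₂ * Σ₁)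
        ≡⟨ cong (_* (c₁ * e P ⊥ ⊤ + c₁ * Σd + c₂ * Σ₁)) sign ⟩
      neg1^ (suc k₀) * (c₁ * e P ⊥ ⊤ + c₁ * Σd + c₂ * Σ₁) ∎
      where
      open ≡-Reasoning
      k₀ = d ∸ i
      c₁ c₂ : ℤ
      c₁ = + (suc d C suc i)
      c₂ = + (d C i)
      k₀≤1+d : k₀ ≤ suc d
      k₀≤1+d = ℕP.≤-trans (ℕP.m∸n≤m d i) (ℕP.n≤1+n d)
      k₀≤half : k₀ ≤ ⌊ d /2⌋
      k₀≤half = ℕP.≤-trans (ℕP.∸-monoʳ-≤ d (ℕP.≤-pred half<1+i))
        (ℕP.≤-reflexive (trans (cong (_∸ ⌊ suc d /2⌋) (sym (ℕP.⌊n/2⌋+⌈n/2⌉≡n d))) (ℕP.m+n∸n≡m ⌊ d /2⌋ ⌊ suc d /2⌋)))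
      sign : neg1^ (suc d) * neg1^ i ≡ neg1^ (suc k₀)
      sign = trans (sym (neg1^-∸ z≤n (ℕP.m≤n⇒m≤1+n i≤d))) (cong neg1^ (ℕP.+-∸-assoc 1 i≤d))
      collect : ∀ p q c₁ c₂ e₀ Σd Σ₁ →
        - (- (- p * (e₀ + Σd)) * (- q * c₁) + (- p * (q * c₂)) * Σ₁ + + 0) ≡ (p * q) * (c₁ * e₀ + c₁ * Σd + c₂ * Σ₁)
      collect = solve-∀

theorem5p6 : (P : FinGradedPoset) (d : ℕ) → ρ P (top P) ≡ suc d → OneSing P d →
    (i : ℕ) → ⌊ d /2⌋ < i → i ≤ d →
    hhatCoeff P d (d ∸ i) - hhatCoeff P d i
      ≡ neg1^ (suc (d ∸ i))
        * ( (+ (d C i)) * e P (bot P) (top P)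
          + (+ (d C i)) * sumRank P d (λ t → e P (bot P) t)
          + (+ ((d ∸ 1) C (i ∸ 1))) * sumRank P 1 (λ s → e P s (top P)) )
theorem5p6 P zero    _   _        zero    ()       _
theorem5p6 P zero    _   _        (suc i) _        ()
theorem5p6 P (suc d) _   _        zero    ()       _
theorem5p6 P (suc d) ρ⊤≡ oneSing (suc i) half<1+i (s≤s i≤d) = begin
  hhatCoeff P (suc d) (d ∸ i) - hhatCoeff P (suc d) (suc i)
    ≡⟨ cong₂ _-_ (trans (coeff-hhat P (top P) (suc d) (suc d ∸ (d ∸ i))) (cong ĥ⊤ (ℕP.m∸[m∸n]≡n (s≤s i≤d))))
                 (coeff-hhat P (top P) (suc d) (d ∸ i)) ⟩
  ĥ⊤ (suc i) - ĥ⊤ (d ∸ i)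
    ≡⟨ ĥ⊤-difference i half<1+i i≤d ⟩
  neg1^ (suc (d ∸ i)) * (c₁ * e P (bot P) (top P) + c₁ * Σd + c₂ * Σ₁)
    ≡⟨ cong₂ (λ x y → neg1^ (suc (d ∸ i)) * (c₁ * e P (bot P) (top P) + c₁ * x + c₂ * y))
             (sym (sumFin≡sum (λ u → when ⌊ ρ P u ℕ.≟ suc d ⌋ (e P (bot P) u))))
             (sym (sumFin≡sum (λ v → when ⌊ ρ P v ℕ.≟ 1 ⌋ (e P v (top P))))) ⟩
  neg1^ (suc (d ∸ i)) * (c₁ * e P (bot P) (top P) + c₁ * sumRank P (suc d) (e P (bot P)) + c₂ * sumRank P 1 (λ s → e P s (top P))) ∎
  where
  open ≡-Reasoning
  open TopRank P ρ⊤≡ oneSing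
  c₁ c₂ : ℤ
  c₁ = + (suc d C suc i)
  c₂ = + (d C i)
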